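{- The number $p_n$ of inequivalent integer polygons with perimeter $n$ satisfies $p_n\sim \frac{2^{n-1}}{n}$ as $n\to\infty$.
   Context: An integer polygon is a polygon (with any number $m\geq3$ of sides) whose side lengths are all positive integers; its perimeter is the sum of its side lengths. Reading the side lengths of an $m$-gon starting from any side, clockwise or anticlockwise, gives an $m$-tuple; two polygons are equivalent if they have the same number of sides and the $m$-tuple of one can be obtained from that of the other by cyclically re-ordering and/or reversing the entries. (Side-length tuples of integer polygons of perimeter $n$ are exactly tuples of length $m\geq3$ of positive integers summing to $n$ with every entry less than $n/2$.) $f\sim g$ means $f/g\to1$. -}

module Defs where

open import Data.Nat using (ℕ; zero; suc; _+_; _*_; _∸_; _<_; _≤_; _<ᵇ_)
import Data.Nat.Properties as ℕP
open import Data.List using (List; []; _∷_; _++_; map; concatMap; filter; length; upTo; reverse; drop; take; deduplicate)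
import Data.List.Properties as LP
open import Data.Nat.ListAction using (sum)
open import Data.List.Relation.Unary.All using (All)
import Data.List.Relation.Unary.All as All
open import Data.List.Membership.Propositional using (_∈_)
open import Data.List.Membership.DecPropositional (LP.≡-dec ℕP._≟_) using (_∈?_)
open import Relation.Binary.PropositionalEquality using (_≡_)
open import Relation.Binary.Definitions using (Decidable)
open import Relation.Nullary using (Dec; _×-dec_)

tuples : ℕ → ℕ → List (List ℕ)
tuples zero    n = [] ∷ []
tuples (suc m) n = concatMap (λ a → map (a ∷_) (tuples m n)) (map suc (upTo n))

candidates : ℕ → List (List ℕ)
candidates n = concatMap (λ m → tuples m n) (upTo (suc n))

-- side-length tuple of an integer polygon of perimeter n:
-- length ≥ 3, positive entries summing to n, every entry < n/2 (i.e. 2a < n)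
IsPolygonTuple : ℕ → List ℕ → Set
IsPolygonTuple n xs = (3 ≤ length xs) × (sum xs ≡ n) × All (λ a → 2 * a < n) xs
  where open import Data.Product using (_×_)

isPolygonTuple? : (n : ℕ) → (xs : List ℕ) → Dec (IsPolygonTuple n xs)
isPolygonTuple? n xs =
  (3 ℕP.≤? length xs) ×-dec ((sum xs ℕP.≟ n) ×-dec All.all? (λ a → suc (2 * a) ℕP.≤? n) xs)

polygonTuples : ℕ → List (List ℕ)
polygonTuples n = filter (isPolygonTuple? n) (candidates n)

rotate : ℕ → List ℕ → List ℕ
rotate k xs = drop k xs ++ take k xs

orbit : List ℕ → List (List ℕ)
orbit xs = map (λ k → rotate k xs) (upTo (length xs))
        ++ map (λ k → rotate k (reverse xs)) (upTo (length xs))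

Equivalent : List ℕ → List ℕ → Set
Equivalent xs ys = ys ∈ orbit xs

equivalent? : Decidable Equivalent
equivalent? xs ys = ys ∈? orbit xs

p : ℕ → ℕ
p n = length (deduplicate equivalent? (polygonTuples n))

module Submission where

-- The proof is a weighted count.  A
-- composition x of n gets the weight n!/length x; as C(n-1,k-1) of the 2^(n-1)
-- compositions have k parts, the total weight is n!(2^n - 1)/n
-- (composition-weights).  A class of polygon tuples without rotational or
-- reflection symmetry consists of exactly 2·length d tuples, so its weight is
-- exactly 2·n!.  Hence 2·n!·p n equals the total weight up to two kinds of
-- exceptions: symmetric classes, and compositions that are not polygon tuples.
-- Both are encoded injectively by keys built from a composition of at most
-- n/2, so there are only O(n^4·2^(n/2)) of them, which is negligible against
-- 2^(n-1).

open import Defs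
open import Data.Nat using (ℕ; zero; suc; _+_; _*_; _∸_; _^_; _≤_; _<_; _⊓_; z≤n; s≤s; s≤s⁻¹; _!; ⌊_/2⌋; NonZero; >-nonZero; ∣_-_∣)
open import Data.Nat.Properties
open import Algebra.Properties.CommutativeSemigroup +-commutativeSemigroup using () renaming (x∙yz≈y∙xz to +-exchange)
open import Data.Nat.Combinatorics using (_C_; nCk+nC[k+1]≡[n+1]C[k+1]; k>n⇒nCk≡0; nC1≡n)
open import Data.Nat.ListAction using (sum)
open import Data.Nat.ListAction.Properties using (sum-++; sum-↭)
open import Data.Nat.Tactic.RingSolver using (solve-∀)
open import Data.List using (List; []; _∷_; _++_; map; length; upTo; reverse; drop; take; filter; concatMap; deduplicate; cartesianProduct)
import Data.List.Properties as Listₚ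
open import Data.List.Relation.Unary.All as All using (All; []; _∷_)
import Data.List.Relation.Unary.All.Properties as Allₚ
open import Data.List.Relation.Unary.All.Properties.Core using (¬All⇒Any¬)
open import Data.List.Relation.Unary.Any as Any using (Any; here; there)
import Data.List.Relation.Unary.Any.Properties as Anyₚ
open import Data.List.Relation.Unary.AllPairs as AllPairs using (AllPairs; []; _∷_)
import Data.List.Relation.Unary.AllPairs.Properties as AllPairsₚ
open import Data.List.Relation.Unary.Unique.Propositional using (Unique)
import Data.List.Relation.Unary.Unique.Propositional.Properties as Uniqueₚ
open import Data.List.Relation.Binary.Disjoint.Propositional using (Disjoint)
open import Data.List.Relation.Binary.Permutation.Propositional using (_↭_; ↭-sym; ↭-trans; ↭-reflexive)
open import Data.List.Relation.Binary.Permutation.Propositional.Properties using (++-comm; ↭-reverse; ↭-length; All-resp-↭)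
open import Data.List.Membership.Propositional using (_∈_; lose; find)
open import Data.List.Membership.Propositional.Properties
  using (∈-++⁻; ∈-++⁺ˡ; ∈-++⁺ʳ; ∈-map⁻; ∈-map⁺; ∈-upTo⁻; ∈-upTo⁺; ∈-concatMap⁺; ∈-concatMap⁻; ∈-filter⁺; ∈-filter⁻; ∈-cartesianProduct⁺; ∈-∃++)
open import Data.Product using (Σ; _×_; _,_; proj₁; proj₂)
import Data.Product.Properties as Productₚ
open import Data.Sum using (_⊎_; inj₁; inj₂)
import Data.Sum.Properties as Sumₚ
open import Data.Empty using (⊥; ⊥-elim)
open import Relation.Nullary using (yes; no; ¬_; Dec; ¬?)
open import Relation.Nullary.Decidable using (_⊎-dec_; _×-dec_)
open import Relation.Binary.Definitions using (DecidableEquality)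
open import Relation.Binary.PropositionalEquality
open import Function using (_∘_)

∑ : {A : Set} → (A → ℕ) → List A → ℕ
∑ w []       = 0
∑ w (x ∷ xs) = w x + ∑ w xs

∑-const : {A : Set} (c : ℕ) (xs : List A) → ∑ (λ _ → c) xs ≡ c * length xs
∑-const c []       = sym (*-zeroʳ c)
∑-const c (x ∷ xs) = trans (cong (c +_) (∑-const c xs)) (sym (*-suc c (length xs)))

∑-one : {A : Set} (xs : List A) → ∑ (λ _ → 1) xs ≡ length xs
∑-one xs = trans (∑-const 1 xs) (*-identityˡ (length xs))

∑-++ : {A : Set} (w : A → ℕ) (xs ys : List A) → ∑ w (xs ++ ys) ≡ ∑ w xs + ∑ w ys
∑-++ w []       ys = refl
∑-++ w (x ∷ xs) ys = trans (cong (w x +_) (∑-++ w xs ys)) (sym (+-assoc (w x) _ _))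

∑-map : {A B : Set} (w : B → ℕ) (f : A → B) (xs : List A) → ∑ w (map f xs) ≡ ∑ (w ∘ f) xs
∑-map w f []       = refl
∑-map w f (x ∷ xs) = cong (w (f x) +_) (∑-map w f xs)

∑-concatMap : {A B : Set} (w : B → ℕ) (f : A → List B) (xs : List A) →
              ∑ w (concatMap f xs) ≡ ∑ (λ x → ∑ w (f x)) xs
∑-concatMap w f []       = refl
∑-concatMap w f (x ∷ xs) = trans (∑-++ w (f x) (concatMap f xs)) (cong (∑ w (f x) +_) (∑-concatMap w f xs))

∑-cong : {A : Set} {w w′ : A → ℕ} (xs : List A) → (∀ {x} → x ∈ xs → w x ≡ w′ x) → ∑ w xs ≡ ∑ w′ xs
∑-cong []       eq = refl
∑-cong (x ∷ xs) eq = cong₂ _+_ (eq (here refl)) (∑-cong xs (eq ∘ there))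

∑-mono : {A : Set} {w w′ : A → ℕ} (xs : List A) → (∀ {x} → x ∈ xs → w x ≤ w′ x) → ∑ w xs ≤ ∑ w′ xs
∑-mono []       le = z≤n
∑-mono (x ∷ xs) le = +-mono-≤ (le (here refl)) (∑-mono xs (le ∘ there))

∑-filter : {A : Set} {P : A → Set} (P? : ∀ x → Dec (P x)) (w : A → ℕ) (xs : List A) →
           ∑ w (filter P? xs) + ∑ w (filter (¬? ∘ P?) xs) ≡ ∑ w xs
∑-filter P? w [] = refl
∑-filter P? w (x ∷ xs) with P? x
... | yes _ = trans (+-assoc (w x) _ _) (cong (w x +_) (∑-filter P? w xs))
... | no  _ = trans (+-exchange (∑ w (filter P? xs)) (w x) _) (cong (w x +_) (∑-filter P? w xs))

-- Each used y is removed from ys as it is matched.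
module _ {A B : Set} (_≟_ : DecidableEquality B) where

  private
    remove : B → List B → List B
    remove y [] = []
    remove y (z ∷ zs) with y ≟ z
    ... | yes _ = zs
    ... | no  _ = z ∷ remove y zs

    ∑-remove : (v : B → ℕ) → ∀ {y ys} → y ∈ ys → ∑ v ys ≡ v y + ∑ v (remove y ys)
    ∑-remove v {y} {z ∷ zs} y∈ with y ≟ z
    ∑-remove v {y} {z ∷ zs} y∈          | yes refl = refl
    ∑-remove v {y} {z ∷ zs} (here refl) | no y≢z   = ⊥-elim (y≢z refl)
    ∑-remove v {y} {z ∷ zs} (there y∈)  | no _     =
      trans (cong (v z +_) (∑-remove v y∈)) (+-exchange (v z) (v y) _)

    ∈-remove : ∀ {y y′ ys} → y′ ∈ ys → y′ ≢ y → y′ ∈ remove y ys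
    ∈-remove {y} {y′} {z ∷ zs} y′∈ y′≢y with y ≟ z
    ∈-remove (here refl)  y′≢y | yes refl = ⊥-elim (y′≢y refl)
    ∈-remove (there y′∈) y′≢y | yes refl = y′∈
    ∈-remove (here refl)  y′≢y | no _     = here refl
    ∈-remove (there y′∈) y′≢y | no _     = there (∈-remove y′∈ y′≢y)

  ∑-≤-injection : (R : A → B → Set) (w : A → ℕ) (v : B → ℕ) →
                  (∀ {x x′ y} → R x y → R x′ y → x ≡ x′) →
                  (∀ {x y} → R x y → w x ≤ v y) →
                  ∀ (xs : List A) (ys : List B) → Unique xs →
                  (∀ {x} → x ∈ xs → Σ B (λ y → y ∈ ys × R x y)) →
                  ∑ w xs ≤ ∑ v ys
  ∑-≤-injection R w v inj w≤v []       ys _ _ = z≤n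
  ∑-≤-injection R w v inj w≤v (x ∷ xs) ys (x∉xs ∷ uxs) partner with partner (here refl)
  ... | y , y∈ys , Rxy =
    subst (w x + ∑ w xs ≤_) (sym (∑-remove v y∈ys))
          (+-mono-≤ (w≤v Rxy) (∑-≤-injection R w v inj w≤v xs (remove y ys) uxs partner′))
    where
    partner′ : ∀ {x′} → x′ ∈ xs → Σ B (λ y′ → y′ ∈ remove y ys × R x′ y′)
    partner′ {x′} x′∈ with partner (there x′∈)
    ... | y′ , y′∈ , Rx′y′ =
      y′ , ∈-remove y′∈ (λ { refl → All.lookup x∉xs x′∈ (inj Rxy Rx′y′) }) , Rx′y′

  length-≤-keys : (R : A → B → Set) → (∀ {x x′ y} → R x y → R x′ y → x ≡ x′) →
                  ∀ (xs : List A) (keys : List B) → Unique xs →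
                  (∀ {x} → x ∈ xs → Σ B (λ y → y ∈ keys × R x y)) →
                  length xs ≤ length keys
  length-≤-keys R inj xs keys uxs key =
    subst₂ _≤_ (∑-one xs) (∑-one keys) (∑-≤-injection R (λ _ → 1) (λ _ → 1) inj (λ _ → ≤-refl) xs keys uxs key)

∑-mono-⊆ : {A : Set} → DecidableEquality A → (w : A → ℕ) (xs ys : List A) →
           Unique xs → (∀ {x} → x ∈ xs → x ∈ ys) → ∑ w xs ≤ ∑ w ys
∑-mono-⊆ _≟_ w xs ys uxs xs⊆ys =
  ∑-≤-injection _≟_ _≡_ w w (λ { refl refl → refl }) (λ { refl → ≤-refl }) xs ys uxs (λ {x} x∈ → x , xs⊆ys x∈ , refl)

module _ {A : Set} where

  take-++ˡ : ∀ i (a b : List A) → i ≤ length a → take i (a ++ b) ≡ take i a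
  take-++ˡ zero    a       b _       = refl
  take-++ˡ (suc i) (x ∷ a) b (s≤s p) = cong (x ∷_) (take-++ˡ i a b p)

  drop-++ˡ : ∀ i (a b : List A) → i ≤ length a → drop i (a ++ b) ≡ drop i a ++ b
  drop-++ˡ zero    a       b _       = refl
  drop-++ˡ (suc i) (x ∷ a) b (s≤s p) = drop-++ˡ i a b p

  take-++ʳ : ∀ t (a b : List A) → take (length a + t) (a ++ b) ≡ a ++ take t b
  take-++ʳ t []      b = refl
  take-++ʳ t (x ∷ a) b = cong (x ∷_) (take-++ʳ t a b)

  drop-++ʳ : ∀ t (a b : List A) → drop (length a + t) (a ++ b) ≡ drop t b
  drop-++ʳ t []      b = refl
  drop-++ʳ t (x ∷ a) b = drop-++ʳ t a b

  take-length-++ : ∀ (a b : List A) → take (length a) (a ++ b) ≡ a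
  take-length-++ []      b = refl
  take-length-++ (x ∷ a) b = cong (x ∷_) (take-length-++ a b)

  drop-length-++ : ∀ (a b : List A) → drop (length a) (a ++ b) ≡ b
  drop-length-++ []      b = refl
  drop-length-++ (x ∷ a) b = drop-length-++ a b

  take-+ : ∀ j i (x : List A) → take (j + i) x ≡ take j x ++ take i (drop j x)
  take-+ zero    i x       = refl
  take-+ (suc j) i []      = sym (Listₚ.take-[] i)
  take-+ (suc j) i (y ∷ x) = cong (y ∷_) (take-+ j i x)

  length-take-≤ : ∀ k (x : List A) → k ≤ length x → length (take k x) ≡ k
  length-take-≤ k x k≤ = trans (Listₚ.length-take k x) (m≤n⇒m⊓n≡m k≤)

  ++-cancel-length : ∀ (a b c d : List A) → length a ≡ length c → a ++ b ≡ c ++ d → a ≡ c × b ≡ d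
  ++-cancel-length []      b []      d _  eq = refl , eq
  ++-cancel-length (x ∷ a) b (y ∷ c) d ℓ eq with Listₚ.∷-injective eq
  ... | refl , eq′ with ++-cancel-length a b c d (suc-injective ℓ) eq′
  ...   | refl , refl = refl , refl

rotate-↭ : ∀ k x → rotate k x ↭ x
rotate-↭ k x = ↭-trans (++-comm (drop k x) (take k x)) (↭-reflexive (Listₚ.take++drop≡id k x))

length-rotate : ∀ k x → length (rotate k x) ≡ length x
length-rotate k x = ↭-length (rotate-↭ k x)

rotate-zero : ∀ x → rotate 0 x ≡ x
rotate-zero = Listₚ.++-identityʳ

rotate-length : ∀ x → rotate (length x) x ≡ x
rotate-length x =
  cong₂ _++_ (Listₚ.drop-all (length x) x ≤-refl) (Listₚ.take-all (length x) x ≤-refl)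

rotate-rotate : ∀ i j x → i + j ≤ length x → rotate i (rotate j x) ≡ rotate (i + j) x
rotate-rotate i j x i+j≤ = begin
  drop i (drop j x ++ take j x) ++ take i (drop j x ++ take j x)
    ≡⟨ cong₂ _++_ (drop-++ˡ i (drop j x) (take j x) i≤) (take-++ˡ i (drop j x) (take j x) i≤) ⟩
  (drop i (drop j x) ++ take j x) ++ take i (drop j x)
    ≡⟨ Listₚ.++-assoc (drop i (drop j x)) _ _ ⟩
  drop i (drop j x) ++ (take j x ++ take i (drop j x))
    ≡⟨ cong₂ _++_ (Listₚ.drop-drop j i x) (sym (take-+ j i x)) ⟩
  drop (j + i) x ++ take (j + i) x
    ≡⟨ cong (λ z → rotate z x) (+-comm j i) ⟩
  rotate (i + j) x
    ∎
  where
  open ≡-Reasoning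
  i≤ : i ≤ length (drop j x)
  i≤ = subst (i ≤_) (sym (Listₚ.length-drop j x))
             (subst (_≤ length x ∸ j) (m+n∸n≡m i j) (∸-monoˡ-≤ j i+j≤))

rotate-wrap : ∀ t j x → j ≤ length x → t ≤ j → rotate ((length x ∸ j) + t) (rotate j x) ≡ rotate t x
rotate-wrap t j x j≤ t≤j = begin
  drop (length x ∸ j + t) (A ++ B) ++ take (length x ∸ j + t) (A ++ B)
    ≡⟨ cong (λ z → drop (z + t) (A ++ B) ++ take (z + t) (A ++ B)) (sym (Listₚ.length-drop j x)) ⟩
  drop (length A + t) (A ++ B) ++ take (length A + t) (A ++ B)
    ≡⟨ cong₂ _++_ (drop-++ʳ t A B) (take-++ʳ t A B) ⟩
  drop t B ++ (A ++ take t B)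
    ≡⟨ Listₚ.++-assoc (drop t B) A _ ⟨
  (drop t B ++ A) ++ take t B
    ≡⟨ cong₂ _++_ drop-t (take-t) ⟩
  drop t x ++ take t x
    ∎
  where
  open ≡-Reasoning
  A = drop j x
  B = take j x
  drop-t : drop t B ++ A ≡ drop t x
  drop-t = trans (sym (drop-++ˡ t B A (subst (t ≤_) (sym (length-take-≤ j x j≤)) t≤j)))
                 (cong (drop t) (Listₚ.take++drop≡id j x))
  take-t : take t B ≡ take t x
  take-t = trans (Listₚ.take-take t j x) (cong (λ z → take z x) (m≤n⇒m⊓n≡m t≤j))

rotate-back : ∀ i x → i ≤ length x → rotate (length x ∸ i) (rotate i x) ≡ x
rotate-back i x i≤ = begin
  rotate (length x ∸ i) (rotate i x)  ≡⟨ rotate-rotate (length x ∸ i) i x (≤-reflexive ∸+i) ⟩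
  rotate (length x ∸ i + i) x         ≡⟨ cong (λ z → rotate z x) ∸+i ⟩
  rotate (length x) x                 ≡⟨ rotate-length x ⟩
  x                                   ∎
  where
  open ≡-Reasoning
  ∸+i : length x ∸ i + i ≡ length x
  ∸+i = m∸n+n≡m i≤

reverse-rotate : ∀ k x → k ≤ length x → reverse (rotate k x) ≡ rotate (length x ∸ k) (reverse x)
reverse-rotate k x k≤ = begin
  reverse (drop k x ++ take k x)
    ≡⟨ Listₚ.reverse-++ (drop k x) (take k x) ⟩
  RT ++ RD
    ≡⟨ cong₂ _++_ (drop-length-++ RD RT) (take-length-++ RD RT) ⟨
  rotate (length RD) (RD ++ RT)
    ≡⟨ cong (λ z → rotate z (RD ++ RT)) (trans (Listₚ.length-reverse (drop k x)) (Listₚ.length-drop k x)) ⟩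
  rotate (length x ∸ k) (RD ++ RT)
    ≡⟨ cong (rotate (length x ∸ k)) (Listₚ.reverse-++ (take k x) (drop k x)) ⟨
  rotate (length x ∸ k) (reverse (take k x ++ drop k x))
    ≡⟨ cong (rotate (length x ∸ k) ∘ reverse) (Listₚ.take++drop≡id k x) ⟩
  rotate (length x ∸ k) (reverse x)
    ∎
  where
  open ≡-Reasoning
  RT = reverse (take k x)
  RD = reverse (drop k x)

Rot : List ℕ → List ℕ → Set
Rot x y = Σ ℕ (λ k → k < length x × y ≡ rotate k x)

rot-≤ : ∀ c x → 0 < length x → c ≤ length x → Rot x (rotate c x)
rot-≤ c x pos c≤ with m≤n⇒m<n∨m≡n c≤
... | inj₁ c< = c , c< , refl
... | inj₂ refl = 0 , pos , trans (rotate-length x) (sym (rotate-zero x))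

rotate-rotate-Rot : ∀ a b x → 0 < length x → a ≤ length x → b ≤ length x → Rot x (rotate a (rotate b x))
rotate-rotate-Rot a b x pos a≤ b≤ with a + b ≤? length x
... | yes a+b≤ = subst (Rot x) (sym (rotate-rotate a b x a+b≤)) (rot-≤ (a + b) x pos a+b≤)
... | no  a+b≰ = subst (Rot x) (sym rot-eq) (rot-≤ t x pos (≤-trans t≤b b≤))
  where
  m = length x
  t = a + b ∸ m
  m≤a+b : m ≤ a + b
  m≤a+b = <⇒≤ (≰⇒> a+b≰)
  m+t≡a+b : m + t ≡ a + b
  m+t≡a+b = m+[n∸m]≡n m≤a+b
  t≤b : t ≤ b
  t≤b = +-cancelˡ-≤ m t b (subst (_≤ m + b) (sym m+t≡a+b) (+-monoˡ-≤ b a≤))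
  a≡ : m ∸ b + t ≡ a
  a≡ = +-cancelʳ-≡ b (m ∸ b + t) a (begin
    m ∸ b + t + b  ≡⟨ x+y+z≡x+z+y (m ∸ b) t b ⟩
    m ∸ b + b + t  ≡⟨ cong (_+ t) (m∸n+n≡m b≤) ⟩
    m + t          ≡⟨ m+t≡a+b ⟩
    a + b          ∎)
    where
    open ≡-Reasoning
    x+y+z≡x+z+y : ∀ x y z → x + y + z ≡ x + z + y
    x+y+z≡x+z+y = solve-∀
  rot-eq : rotate a (rotate b x) ≡ rotate t x
  rot-eq = trans (cong (λ z → rotate z (rotate b x)) (sym a≡)) (rotate-wrap t b x b≤ t≤b)

Rot-length : ∀ {x y} → Rot x y → length y ≡ length x
Rot-length {x} (k , _ , refl) = length-rotate k x

Rot-trans : ∀ {x y z} → 0 < length x → Rot x y → Rot y z → Rot x z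
Rot-trans {x} pos (a , a< , refl) (b , b< , refl) =
  rotate-rotate-Rot b a x pos (subst (b ≤_) (length-rotate a x) (<⇒≤ b<)) (<⇒≤ a<)

Rot-sym : ∀ {x y} → 0 < length x → Rot x y → Rot y x
Rot-sym {x} pos (a , a< , refl) =
  subst (Rot (rotate a x)) (rotate-back a x (<⇒≤ a<)) (rot-≤ (length x ∸ a) (rotate a x) pos′ ∸≤)
  where
  pos′ : 0 < length (rotate a x)
  pos′ = subst (0 <_) (sym (length-rotate a x)) pos
  ∸≤ : length x ∸ a ≤ length (rotate a x)
  ∸≤ = subst (length x ∸ a ≤_) (sym (length-rotate a x)) (m∸n≤m _ a)

length-reverse-pos : ∀ (x : List ℕ) → 0 < length x → 0 < length (reverse x)
length-reverse-pos x pos = subst (0 <_) (sym (Listₚ.length-reverse x)) pos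

Rot-reverse : ∀ {x y} → 0 < length x → Rot x y → Rot (reverse x) (reverse y)
Rot-reverse {x} pos (a , a< , refl) =
  subst (Rot (reverse x)) (sym (reverse-rotate a x (<⇒≤ a<)))
        (rot-≤ (length x ∸ a) (reverse x) (length-reverse-pos x pos)
               (subst (length x ∸ a ≤_) (sym (Listₚ.length-reverse x)) (m∸n≤m _ a)))

-- Dihedral equivalence: y is a rotation of x or of its reversal.
-- This is the relation 'y ∈ orbit x' of the definitions, as a proposition.
Orb : List ℕ → List ℕ → Set
Orb x y = Rot x y ⊎ Rot (reverse x) y

Orb-length : ∀ {x y} → Orb x y → length y ≡ length x
Orb-length     (inj₁ r) = Rot-length r
Orb-length {x} (inj₂ r) = trans (Rot-length r) (Listₚ.length-reverse x)

Orb-refl : ∀ x → 0 < length x → Orb x x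
Orb-refl x pos = inj₁ (0 , pos , sym (rotate-zero x))

Rot-reverse² : ∀ {x y} → 0 < length x → Rot (reverse x) y → Rot x (reverse y)
Rot-reverse² {x} pos r =
  subst (λ w → Rot w _) (Listₚ.reverse-involutive x) (Rot-reverse (length-reverse-pos x pos) r)

Orb-trans : ∀ {x y z} → 0 < length x → Orb x y → Orb y z → Orb x z
Orb-trans     pos (inj₁ r) (inj₁ s) = inj₁ (Rot-trans pos r s)
Orb-trans {x} pos (inj₁ r) (inj₂ s) = inj₂ (Rot-trans (length-reverse-pos x pos) (Rot-reverse pos r) s)
Orb-trans {x} pos (inj₂ r) (inj₁ s) = inj₂ (Rot-trans (length-reverse-pos x pos) r s)
Orb-trans {x} pos (inj₂ r) (inj₂ s) = inj₁ (Rot-trans pos (Rot-reverse² pos r) s)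

Orb-sym : ∀ {x y} → 0 < length x → Orb x y → Orb y x
Orb-sym pos (inj₁ r) = inj₁ (Rot-sym pos r)
Orb-sym pos (inj₂ r) = inj₂ (Rot-sym pos (Rot-reverse² pos r))

∈-orbit⇒Orb : ∀ {x y} → y ∈ orbit x → Orb x y
∈-orbit⇒Orb {x} y∈ with ∈-++⁻ (map (λ k → rotate k x) (upTo (length x))) y∈
... | inj₁ y∈rot with ∈-map⁻ (λ k → rotate k x) y∈rot
...   | k , k∈ , eq = inj₁ (k , ∈-upTo⁻ k∈ , eq)
∈-orbit⇒Orb {x} y∈ | inj₂ y∈rev with ∈-map⁻ (λ k → rotate k (reverse x)) y∈rev
...   | k , k∈ , eq = inj₂ (k , subst (k <_) (sym (Listₚ.length-reverse x)) (∈-upTo⁻ k∈) , eq)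

Orb⇒∈-orbit : ∀ {x y} → Orb x y → y ∈ orbit x
Orb⇒∈-orbit {x} (inj₁ (k , k< , refl)) = ∈-++⁺ˡ (∈-map⁺ (λ k → rotate k x) (∈-upTo⁺ k<))
Orb⇒∈-orbit {x} (inj₂ (k , k< , refl)) =
  ∈-++⁺ʳ (map (λ k → rotate k x) (upTo (length x)))
         (∈-map⁺ (λ k → rotate k (reverse x)) (∈-upTo⁺ (subst (k <_) (Listₚ.length-reverse x) k<)))

-- orbit x lists length x rotations of x and length x rotations of its
-- reversal (with repetitions when x is symmetric).
length-orbit : ∀ x → length (orbit x) ≡ length x + length x
length-orbit x = trans (Listₚ.length-++ (map (λ k → rotate k x) (upTo (length x))))
  (cong₂ _+_ (trans (Listₚ.length-map _ (upTo (length x))) (Listₚ.length-upTo (length x)))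
             (trans (Listₚ.length-map _ (upTo (length x))) (Listₚ.length-upTo (length x))))

Positive : List ℕ → Set
Positive = All (0 <_)

length≤sum : ∀ x → Positive x → length x ≤ sum x
length≤sum []      _         = z≤n
length≤sum (a ∷ x) (a>0 ∷ p) = +-mono-≤ a>0 (length≤sum x p)

bump : List ℕ → List ℕ
bump []      = []
bump (a ∷ x) = suc a ∷ x

-- compositions s lists the 2^s compositions (ordered lists of positive
-- parts) of s+1: a composition of s+2 either starts with a part 1 or
-- arises from a composition of s+1 by bumping its first part.
compositions : ℕ → List (List ℕ)
compositions zero    = (1 ∷ []) ∷ []
compositions (suc s) = map (1 ∷_) (compositions s) ++ map bump (compositions s)

length-compositions : ∀ s → length (compositions s) ≡ 2 ^ s
length-compositions zero    = refl
length-compositions (suc s) = begin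
  length (map (1 ∷_) (compositions s) ++ map bump (compositions s))
    ≡⟨ Listₚ.length-++ (map (1 ∷_) (compositions s)) ⟩
  length (map (1 ∷_) (compositions s)) + length (map bump (compositions s))
    ≡⟨ cong₂ _+_ (Listₚ.length-map _ (compositions s)) (Listₚ.length-map _ (compositions s)) ⟩
  length (compositions s) + length (compositions s)
    ≡⟨ cong (λ z → z + z) (length-compositions s) ⟩
  2 ^ s + 2 ^ s
    ≡⟨ cong (2 ^ s +_) (+-identityʳ (2 ^ s)) ⟨
  2 ^ suc s
    ∎
  where open ≡-Reasoning

∈-compositions⁻ : ∀ s {x} → x ∈ compositions s → Positive x × sum x ≡ suc s
∈-compositions⁻ zero    (here refl) = (s≤s z≤n ∷ []) , refl
∈-compositions⁻ (suc s) x∈ with ∈-++⁻ (map (1 ∷_) (compositions s)) x∈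
... | inj₁ x∈₁ with ∈-map⁻ (1 ∷_) x∈₁
...   | y , y∈ , refl with ∈-compositions⁻ s y∈
...     | py , sy = (s≤s z≤n ∷ py) , cong suc sy
∈-compositions⁻ (suc s) x∈ | inj₂ x∈₂ with ∈-map⁻ bump x∈₂
...   | y , y∈ , refl with y | ∈-compositions⁻ s y∈
...     | a ∷ r | (_ ∷ pr) , sy = (s≤s z≤n ∷ pr) , cong suc sy

∈-compositions⁺ : ∀ s x → Positive x → sum x ≡ suc s → x ∈ compositions s
∈-compositions⁺ s       []                    _                    ()
∈-compositions⁺ zero    (1 ∷ [])              _                    _  = here refl
∈-compositions⁺ zero    (1 ∷ b ∷ r)           (_ ∷ s≤s _ ∷ _)      eq with () ← suc-injective eq
∈-compositions⁺ zero    (suc (suc a) ∷ r)     _                    eq with () ← suc-injective eq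
∈-compositions⁺ (suc s) (1 ∷ r)               (_ ∷ pr)             eq =
  ∈-++⁺ˡ (∈-map⁺ (1 ∷_) (∈-compositions⁺ s r pr (suc-injective eq)))
∈-compositions⁺ (suc s) (suc (suc a) ∷ r)     (_ ∷ pr)             eq =
  ∈-++⁺ʳ (map (1 ∷_) (compositions s))
         (∈-map⁺ bump (∈-compositions⁺ s (suc a ∷ r) (s≤s z≤n ∷ pr) (suc-injective eq)))

compositions-unique : ∀ s → Unique (compositions s)
compositions-unique zero    = [] ∷ []
compositions-unique (suc s) =
  Uniqueₚ.++⁺ (Uniqueₚ.map⁺ (proj₂ ∘ Listₚ.∷-injective) (compositions-unique s))
              (Uniqueₚ.map⁺ bump-injective (compositions-unique s))
              disjoint
  where
  bump-injective : ∀ {x y} → bump x ≡ bump y → x ≡ y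
  bump-injective {[]}    {[]}    _    = refl
  bump-injective {_ ∷ _} {_ ∷ _} refl = refl
  -- a bumped composition starts with a part at least 2
  disjoint : ∀ {z} → z ∈ map (1 ∷_) (compositions s) × z ∈ map bump (compositions s) → ⊥
  disjoint (z∈₁ , z∈₂) with ∈-map⁻ (1 ∷_) z∈₁ | ∈-map⁻ bump z∈₂
  ... | _ , _ , refl | a ∷ _ , y∈ , eq with ∈-compositions⁻ s y∈
  ...   | (a>0 ∷ _) , _ = <-irrefl (suc-injective (proj₁ (Listₚ.∷-injective eq))) a>0

compositionsUpTo : ℕ → List (List ℕ)
compositionsUpTo K = [] ∷ concatMap compositions (upTo K)

length-compositionsUpTo : ∀ K → length (compositionsUpTo K) ≡ 2 ^ K
length-compositionsUpTo K = begin
  suc (length (concatMap compositions (upTo K)))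
    ≡⟨ cong suc (∑-one (concatMap compositions (upTo K))) ⟨
  suc (∑ (λ _ → 1) (concatMap compositions (upTo K)))
    ≡⟨ cong suc (∑-concatMap (λ _ → 1) compositions (upTo K)) ⟩
  suc (∑ (λ s → ∑ (λ _ → 1) (compositions s)) (upTo K))
    ≡⟨ cong suc (∑-cong (upTo K) (λ {s} _ → trans (∑-one (compositions s)) (length-compositions s))) ⟩
  suc (∑ (2 ^_) (upTo K))
    ≡⟨ geometric K ⟩
  2 ^ K
    ∎
  where
  open ≡-Reasoning
  geometric : ∀ K → suc (∑ (2 ^_) (upTo K)) ≡ 2 ^ K
  geometric zero    = refl
  geometric (suc K) = begin
    suc (∑ (2 ^_) (upTo (suc K)))            ≡⟨ cong (suc ∘ ∑ (2 ^_)) (Listₚ.upTo-∷ʳ K) ⟨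
    suc (∑ (2 ^_) (upTo K ++ K ∷ []))        ≡⟨ cong suc (∑-++ (2 ^_) (upTo K) (K ∷ [])) ⟩
    suc (∑ (2 ^_) (upTo K) + (2 ^ K + 0))    ≡⟨ cong (_+ (2 ^ K + 0)) (geometric K) ⟩
    2 ^ K + (2 ^ K + 0)                      ∎

∈-compositionsUpTo : ∀ K x → Positive x → sum x ≤ K → x ∈ compositionsUpTo K
∈-compositionsUpTo K []          _        _ = here refl
∈-compositionsUpTo K (zero ∷ x)  (() ∷ _) _
∈-compositionsUpTo K (suc a ∷ x) p sum≤ =
  there (∈-concatMap⁺ compositions (lose (∈-upTo⁺ sum≤) (∈-compositions⁺ (a + sum x) (suc a ∷ x) p refl)))

∑< : ℕ → (ℕ → ℕ) → ℕ
∑< zero    f = 0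
∑< (suc N) f = f 0 + ∑< N (f ∘ suc)

∑<-cong : ∀ N {f g} → (∀ k → k < N → f k ≡ g k) → ∑< N f ≡ ∑< N g
∑<-cong zero    eq = refl
∑<-cong (suc N) eq = cong₂ _+_ (eq 0 (s≤s z≤n)) (∑<-cong N (λ k k< → eq (suc k) (s≤s k<)))

∑<-+ : ∀ N f g → ∑< N (λ k → f k + g k) ≡ ∑< N f + ∑< N g
∑<-+ zero    f g = refl
∑<-+ (suc N) f g = trans (cong (f 0 + g 0 +_) (∑<-+ N _ _)) (a+b+[c+d]≡a+c+[b+d] (f 0) (g 0) _ _)
  where
  a+b+[c+d]≡a+c+[b+d] : ∀ a b c d → a + b + (c + d) ≡ a + c + (b + d)
  a+b+[c+d]≡a+c+[b+d] = solve-∀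

∑<-*ˡ : ∀ N c f → c * ∑< N f ≡ ∑< N (λ k → c * f k)
∑<-*ˡ zero    c f = *-zeroʳ c
∑<-*ˡ (suc N) c f = trans (*-distribˡ-+ c (f 0) _) (cong (c * f 0 +_) (∑<-*ˡ N c _))

∑<-last : ∀ N f → ∑< (suc N) f ≡ ∑< N f + f N
∑<-last zero    f = +-identityʳ (f 0)
∑<-last (suc N) f = trans (cong (f 0 +_) (∑<-last N (f ∘ suc))) (sym (+-assoc (f 0) _ _))

∑<-drop-top : ∀ N f → f N ≡ 0 → ∑< (suc N) f ≡ ∑< N f
∑<-drop-top N f top = trans (∑<-last N f) (trans (cong (∑< N f +_) top) (+-identityʳ _))

pascal : ∀ n k → suc n C suc k ≡ n C k + n C suc k
pascal n k = sym (nCk+nC[k+1]≡[n+1]C[k+1] n k)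

binomial-row : ∀ n → ∑< (suc n) (n C_) ≡ 2 ^ n
binomial-row zero    = refl
binomial-row (suc n) = begin
  1 + ∑< (suc n) (λ k → suc n C suc k)
    ≡⟨ cong (1 +_) (∑<-cong (suc n) {g = λ k → n C k + n C suc k} (λ k _ → pascal n k)) ⟩
  1 + ∑< (suc n) (λ k → n C k + n C suc k)
    ≡⟨ cong (1 +_) (∑<-+ (suc n) (n C_) (λ k → n C suc k)) ⟩
  1 + (∑< (suc n) (n C_) + ∑< (suc n) (λ k → n C suc k))
    ≡⟨ cong (λ z → 1 + (z + ∑< (suc n) (λ k → n C suc k))) (binomial-row n) ⟩
  1 + (2 ^ n + ∑< (suc n) (λ k → n C suc k))
    ≡⟨ +-exchange 1 (2 ^ n) _ ⟩
  2 ^ n + ∑< (suc (suc n)) (n C_)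
    ≡⟨ cong (2 ^ n +_) (∑<-drop-top (suc n) (n C_) (k>n⇒nCk≡0 (n<1+n n))) ⟩
  2 ^ n + ∑< (suc n) (n C_)
    ≡⟨ cong (2 ^ n +_) (trans (binomial-row n) (sym (+-identityʳ (2 ^ n)))) ⟩
  2 ^ suc n
    ∎
  where
  open ≡-Reasoning

binomial-absorb : ∀ s k → suc s * (s C k) ≡ suc k * (suc s C suc k)
binomial-absorb zero    zero    = refl
binomial-absorb zero    (suc k) =
  sym (trans (cong (suc (suc k) *_) (k>n⇒nCk≡0 {1} {suc (suc k)} (s≤s (s≤s z≤n)))) (*-zeroʳ (suc (suc k))))
binomial-absorb (suc s) zero    = begin
  suc (suc s) * 1             ≡⟨ *-identityʳ (suc (suc s)) ⟩
  suc (suc s)                 ≡⟨ nC1≡n (suc (suc s)) ⟨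
  suc (suc s) C 1             ≡⟨ +-identityʳ _ ⟨
  1 * (suc (suc s) C 1)       ∎
  where open ≡-Reasoning
binomial-absorb (suc s) (suc k) = begin
  suc (suc s) * (suc s C suc k)
    ≡⟨ cong (suc (suc s) *_) (pascal s k) ⟩
  suc (suc s) * (a + b)
    ≡⟨ step₁ s a b ⟩
  (a + b) + (suc s * a + suc s * b)
    ≡⟨ cong₂ (λ u v → (a + b) + (u + v)) (binomial-absorb s k) (binomial-absorb s (suc k)) ⟩
  (a + b) + (suc k * (suc s C suc k) + suc (suc k) * (suc s C suc (suc k)))
    ≡⟨ cong (λ z → (a + b) + (suc k * z + suc (suc k) * Y)) (pascal s k) ⟩
  (a + b) + (suc k * (a + b) + suc (suc k) * Y)
    ≡⟨ step₂ k (a + b) Y ⟩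
  suc (suc k) * ((a + b) + Y)
    ≡⟨ cong (λ z → suc (suc k) * (z + Y)) (pascal s k) ⟨
  suc (suc k) * (suc s C suc k + Y)
    ≡⟨ cong (suc (suc k) *_) (pascal (suc s) (suc k)) ⟨
  suc (suc k) * (suc (suc s) C suc (suc k))
    ∎
  where
  open ≡-Reasoning
  a = s C k
  b = s C suc k
  Y = suc s C suc (suc k)
  step₁ : ∀ s a b → suc (suc s) * (a + b) ≡ (a + b) + (suc s * a + suc s * b)
  step₁ = solve-∀
  step₂ : ∀ k X Y → X + (suc k * X + suc (suc k) * Y) ≡ suc (suc k) * (X + Y)
  step₂ = solve-∀

length-bump : ∀ x → length (bump x) ≡ length x
length-bump []      = refl
length-bump (a ∷ x) = refl

∑-compositions-by-length : ∀ (g : ℕ → ℕ) s →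
  ∑ (g ∘ length) (compositions s) ≡ ∑< (suc s) (λ k → (s C k) * g (suc k))
∑-compositions-by-length g zero    = trans (+-identityʳ (g 1)) (sym (trans (+-identityʳ _) (*-identityˡ (g 1))))
∑-compositions-by-length g (suc s) = begin
  ∑ (g ∘ length) (map (1 ∷_) (compositions s) ++ map bump (compositions s))
    ≡⟨ ∑-++ (g ∘ length) (map (1 ∷_) (compositions s)) _ ⟩
  ∑ (g ∘ length) (map (1 ∷_) (compositions s)) + ∑ (g ∘ length) (map bump (compositions s))
    ≡⟨ cong₂ _+_ (∑-map (g ∘ length) (1 ∷_) (compositions s))
                 (trans (∑-map (g ∘ length) bump (compositions s))
                        (∑-cong (compositions s) (λ {x} _ → cong g (length-bump x)))) ⟩
  ∑ (g ∘ suc ∘ length) (compositions s) + ∑ (g ∘ length) (compositions s)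
    ≡⟨ cong₂ _+_ (∑-compositions-by-length (g ∘ suc) s) (∑-compositions-by-length g s) ⟩
  ∑< (suc s) lower + ∑< (suc s) (λ k → (s C k) * g (suc k))
    ≡⟨ cong (∑< (suc s) lower +_) bottom ⟩
  ∑< (suc s) lower + (g 1 + ∑< (suc s) upper)
    ≡⟨ +-exchange (∑< (suc s) lower) (g 1) _ ⟩
  g 1 + (∑< (suc s) lower + ∑< (suc s) upper)
    ≡⟨ cong (g 1 +_) (∑<-+ (suc s) lower upper) ⟨
  g 1 + ∑< (suc s) (λ k → lower k + upper k)
    ≡⟨ cong (g 1 +_) (∑<-cong (suc s) {g = λ k → (suc s C suc k) * g (suc (suc k))} pascal-step) ⟩
  g 1 + ∑< (suc s) (λ k → (suc s C suc k) * g (suc (suc k)))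
    ≡⟨ cong (_+ ∑< (suc s) (λ k → (suc s C suc k) * g (suc (suc k)))) (*-identityˡ (g 1)) ⟨
  ∑< (suc (suc s)) (λ k → (suc s C k) * g (suc k))
    ∎
  where
  open ≡-Reasoning
  lower upper : ℕ → ℕ
  lower k = (s C k) * g (suc (suc k))
  upper k = (s C suc k) * g (suc (suc k))
  -- the one-part composition s+1 is counted by C(s,0) = 1
  bottom : ∑< (suc s) (λ k → (s C k) * g (suc k)) ≡ g 1 + ∑< (suc s) upper
  bottom = cong₂ _+_ (*-identityˡ (g 1)) (sym (∑<-drop-top s upper (cong (_* g (suc (suc s))) (k>n⇒nCk≡0 (n<1+n s)))))
  pascal-step : ∀ k → k < suc s → lower k + upper k ≡ (suc s C suc k) * g (suc (suc k))
  pascal-step k _ = trans (sym (*-distribʳ-+ (g (suc (suc k))) (s C k) (s C suc k))) (cong (_* g (suc (suc k))) (sym (pascal s k)))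

-- factorialExcept n l is the product of 1, …, n with the factor l left
-- out, i.e. n!/l when 1 ≤ l ≤ n.  It is the weight n!/(number of parts)
-- with which compositions of n are counted.
factorialExcept : ℕ → ℕ → ℕ
factorialExcept zero    l = 1
factorialExcept (suc n) l with suc n ≟ l
... | yes _ = factorialExcept n l
... | no  _ = suc n * factorialExcept n l

factorialExcept-> : ∀ n l → n < l → factorialExcept n l ≡ n !
factorialExcept-> zero    l _ = refl
factorialExcept-> (suc n) l n<l with suc n ≟ l
... | yes refl = ⊥-elim (<-irrefl refl n<l)
... | no  _    = cong (suc n *_) (factorialExcept-> n l (<-trans (n<1+n n) n<l))

factorialExcept-spec : ∀ n l → 0 < l → l ≤ n → l * factorialExcept n l ≡ n !
factorialExcept-spec zero    (suc l) _   ()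
factorialExcept-spec (suc n) l l>0 l≤ with suc n ≟ l
... | yes refl = cong (suc n *_) (factorialExcept-> n (suc n) ≤-refl)
... | no  l≢  = trans (a*[b*c]≡b*[a*c] l (suc n) (factorialExcept n l))
                      (cong (suc n *_) (factorialExcept-spec n l l>0 (s≤s⁻¹ (≤∧≢⇒< l≤ (l≢ ∘ sym)))))
  where
  a*[b*c]≡b*[a*c] : ∀ a b c → a * (b * c) ≡ b * (a * c)
  a*[b*c]≡b*[a*c] = solve-∀

factorialExcept-≤ : ∀ n l → 0 < l → l ≤ n → factorialExcept n l ≤ n !
factorialExcept-≤ n l l>0 l≤ =
  subst (factorialExcept n l ≤_) (factorialExcept-spec n l l>0 l≤) (m≤n*m (factorialExcept n l) l {{>-nonZero l>0}})

-- By grouping by length this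
-- is ∑_k C(s,k)·n!/(k+1) and absorption turns n·C(s,k)/(k+1) into C(n,k+1).
composition-weights : ∀ s →
  suc s * ∑ (factorialExcept (suc s) ∘ length) (compositions s) + suc s ! ≡ suc s ! * 2 ^ suc s
composition-weights s = begin
  n * ∑ (w ∘ length) (compositions s) + n !
    ≡⟨ cong (λ z → n * z + n !) (∑-compositions-by-length w s) ⟩
  n * ∑< n (λ k → (s C k) * w (suc k)) + n !
    ≡⟨ cong (_+ n !) (∑<-*ˡ n n (λ k → (s C k) * w (suc k))) ⟩
  ∑< n (λ k → n * ((s C k) * w (suc k))) + n !
    ≡⟨ cong (_+ n !) (∑<-cong n {g = λ k → n ! * (n C suc k)} absorb) ⟩
  ∑< n (λ k → n ! * (n C suc k)) + n !
    ≡⟨ cong (_+ n !) (∑<-*ˡ n (n !) (λ k → n C suc k)) ⟨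
  n ! * ∑< n (λ k → n C suc k) + n !
    ≡⟨ a*b+a≡a*[1+b] (n !) (∑< n (λ k → n C suc k)) ⟩
  n ! * ∑< (suc n) (n C_)
    ≡⟨ cong (n ! *_) (binomial-row n) ⟩
  n ! * 2 ^ n
    ∎
  where
  open ≡-Reasoning
  n = suc s
  w = factorialExcept n
  a*b+a≡a*[1+b] : ∀ a b → a * b + a ≡ a * (1 + b)
  a*b+a≡a*[1+b] = solve-∀
  a*b*c≡a*c*b : ∀ a b c → a * b * c ≡ a * c * b
  a*b*c≡a*c*b = solve-∀
  absorb : ∀ k → k < n → n * ((s C k) * w (suc k)) ≡ n ! * (n C suc k)
  absorb k k< = begin
    n * ((s C k) * w (suc k))          ≡⟨ *-assoc n (s C k) _ ⟨
    n * (s C k) * w (suc k)            ≡⟨ cong (_* w (suc k)) (binomial-absorb s k) ⟩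
    suc k * (n C suc k) * w (suc k)    ≡⟨ a*b*c≡a*c*b (suc k) (n C suc k) (w (suc k)) ⟩
    suc k * w (suc k) * (n C suc k)    ≡⟨ cong (_* (n C suc k)) (factorialExcept-spec n (suc k) (s≤s z≤n) k<) ⟩
    n ! * (n C suc k)                  ∎

All-≤-sum : ∀ x → All (_≤ sum x) x
All-≤-sum []      = []
All-≤-sum (a ∷ x) = m≤m+n a (sum x) ∷ All.map (λ b≤ → ≤-trans b≤ (m≤n+m (sum x) a)) (All-≤-sum x)

∈-tuples⁻ : ∀ m n {x} → x ∈ tuples m n → Positive x
∈-tuples⁻ zero    n (here refl) = []
∈-tuples⁻ (suc m) n x∈ with find (∈-concatMap⁻ (λ a → map (a ∷_) (tuples m n)) {xs = map suc (upTo n)} x∈)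
... | a , a∈ , x∈′ with ∈-map⁻ (a ∷_) x∈′ | ∈-map⁻ suc a∈
...   | r , r∈ , refl | _ , _ , refl = s≤s z≤n ∷ ∈-tuples⁻ m n r∈

∈-tuples⁺ : ∀ n x → All (λ a → 0 < a × a ≤ n) x → x ∈ tuples (length x) n
∈-tuples⁺ n []          []              = here refl
∈-tuples⁺ n (suc a ∷ x) ((_ , a≤) ∷ px) =
  ∈-concatMap⁺ (λ a → map (a ∷_) (tuples (length x) n))
               (lose (∈-map⁺ suc (∈-upTo⁺ a≤)) (∈-map⁺ (suc a ∷_) (∈-tuples⁺ n x px)))

∈-candidates⁻ : ∀ n {x} → x ∈ candidates n → Positive x
∈-candidates⁻ n x∈ with find (∈-concatMap⁻ (λ m → tuples m n) {xs = upTo (suc n)} x∈)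
... | m , _ , x∈′ = ∈-tuples⁻ m n x∈′

∈-candidates⁺ : ∀ n x → Positive x → sum x ≡ n → x ∈ candidates n
∈-candidates⁺ n x px refl =
  ∈-concatMap⁺ (λ m → tuples m (sum x))
               (lose (∈-upTo⁺ (s≤s (length≤sum x px))) (∈-tuples⁺ (sum x) x (All.zip (px , All-≤-sum x))))

Polygon : ℕ → List ℕ → Set
Polygon n x = IsPolygonTuple n x × Positive x

∈-polygonTuples⁻ : ∀ n {x} → x ∈ polygonTuples n → Polygon n x
∈-polygonTuples⁻ n x∈ with ∈-filter⁻ (isPolygonTuple? n) {xs = candidates n} x∈
... | x∈′ , isPolygon = isPolygon , ∈-candidates⁻ n x∈′

∈-polygonTuples⁺ : ∀ n {x} → Polygon n x → x ∈ polygonTuples n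
∈-polygonTuples⁺ n {x} (isPolygon@(_ , sum≡ , _) , px) =
  ∈-filter⁺ (isPolygonTuple? n) (∈-candidates⁺ n x px sum≡) isPolygon

Polygon-length>0 : ∀ {n x} → Polygon n x → 0 < length x
Polygon-length>0 ((3≤ , _) , _) = <-≤-trans (s≤s z≤n) 3≤

Polygon-length≤ : ∀ {n x} → Polygon n x → length x ≤ n
Polygon-length≤ {x = x} ((_ , sum≡ , _) , px) = subst (length x ≤_) sum≡ (length≤sum x px)

-- Equivalent tuples are permutations of each other, so being a polygon
-- tuple (a condition on length, sum and each entry) is invariant.
Orb-↭ : ∀ {x y} → Orb x y → y ↭ x
Orb-↭ {x} (inj₁ (k , _ , refl)) = rotate-↭ k x
Orb-↭ {x} (inj₂ (k , _ , refl)) = ↭-trans (rotate-↭ k (reverse x)) (↭-reverse x)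

Polygon-↭ : ∀ {n x y} → y ↭ x → Polygon n x → Polygon n y
Polygon-↭ y↭x ((3≤ , sum≡ , small) , px) =
  ( subst (3 ≤_) (sym (↭-length y↭x)) 3≤
  , trans (sum-↭ y↭x) sum≡
  , All-resp-↭ (↭-sym y↭x) small)
  , All-resp-↭ (↭-sym y↭x) px

Polygon-Orb : ∀ {n x y} → Orb x y → Polygon n x → Polygon n y
Polygon-Orb = Polygon-↭ ∘ Orb-↭

classes : ℕ → List (List ℕ)
classes n = deduplicate equivalent? (polygonTuples n)

classes-Polygon : ∀ n → All (Polygon n) (classes n)
classes-Polygon n = All.tabulate (∈-polygonTuples⁻ n ∘ Anyₚ.deduplicate⁻ equivalent?)

classes-cover : ∀ n {x} → Polygon n x → Σ (List ℕ) (λ d → d ∈ classes n × Orb d x)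
classes-cover n {x} px =
  let d , d∈ , (d~x , _) = find (Anyₚ.deduplicate⁺ equivalent? respects (lose (∈-polygonTuples⁺ n px) (Orb-refl x pos , pos)))
  in d , d∈ , d~x
  where
  pos = Polygon-length>0 px
  -- "equivalent to x" is inherited by anything equivalent to a representative
  respects : ∀ {a b} → b ∈ orbit a → Orb b x × 0 < length b → Orb a x × 0 < length a
  respects b∈ (b~x , b>0) =
    let a~b = ∈-orbit⇒Orb b∈
        a>0 = subst (0 <_) (Orb-length a~b) b>0
    in Orb-trans a>0 a~b b~x , a>0

classes-inequivalent : ∀ n → AllPairs (λ a b → ¬ (b ∈ orbit a)) (classes n)
classes-inequivalent n = go (polygonTuples n)
  where
  go : ∀ xs → AllPairs (λ a b → ¬ (b ∈ orbit a)) (deduplicate equivalent? xs)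
  go []       = []
  go (x ∷ xs) = Allₚ.all-filter _ (deduplicate equivalent? xs) ∷ AllPairsₚ.filter⁺ _ (go xs)

-- Tuples with neither symmetry have 2·length x distinct equivalent tuples.
RotSymmetric : List ℕ → Set
RotSymmetric x = Σ ℕ (λ k → k < length x × (0 < k × rotate k x ≡ x))

ReflSymmetric : List ℕ → Set
ReflSymmetric x = Σ ℕ (λ k → k < length x × rotate k (reverse x) ≡ x)

Symmetric : List ℕ → Set
Symmetric x = RotSymmetric x ⊎ ReflSymmetric x

symmetric? : ∀ x → Dec (Symmetric x)
symmetric? x =
  anyUpTo? (λ k → (0 <? k) ×-dec Listₚ.≡-dec _≟_ (rotate k x) x) (length x)
  ⊎-dec anyUpTo? (λ k → Listₚ.≡-dec _≟_ (rotate k (reverse x)) x) (length x)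

equal-rotations⇒RotSymmetric : ∀ (y : List ℕ) i j → i < j → j < length y →
                               rotate i y ≡ rotate j y → RotSymmetric y
equal-rotations⇒RotSymmetric y i j i<j j< eq =
  m ∸ j + i , k< , <-≤-trans (m<n⇒0<n∸m j<) (m≤m+n (m ∸ j) i) , (begin
    rotate (m ∸ j + i) y           ≡⟨ rotate-rotate (m ∸ j) i y (<⇒≤ k<) ⟨
    rotate (m ∸ j) (rotate i y)    ≡⟨ cong (rotate (m ∸ j)) eq ⟩
    rotate (m ∸ j) (rotate j y)    ≡⟨ rotate-back j y (<⇒≤ j<) ⟩
    y                              ∎)
  where
  open ≡-Reasoning
  m = length y
  k< : m ∸ j + i < m
  k< = subst (m ∸ j + i <_) (m∸n+n≡m (<⇒≤ j<)) (+-monoʳ-< (m ∸ j) i<j)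

RotSymmetric-reverse : ∀ x → RotSymmetric (reverse x) → RotSymmetric x
RotSymmetric-reverse x (k , k< , k>0 , eq) =
  m ∸ k , ∸-monoʳ-< k>0 (<⇒≤ k<m) , m<n⇒0<n∸m k<m , (begin
    rotate (m ∸ k) x                                    ≡⟨ cong₂ (λ a b → rotate (a ∸ k) b) (sym ℓ) (sym (Listₚ.reverse-involutive x)) ⟩
    rotate (length (reverse x) ∸ k) (reverse (reverse x)) ≡⟨ reverse-rotate k (reverse x) (<⇒≤ k<) ⟨
    reverse (rotate k (reverse x))                      ≡⟨ cong reverse eq ⟩
    reverse (reverse x)                                 ≡⟨ Listₚ.reverse-involutive x ⟩
    x                                                   ∎)
  where
  open ≡-Reasoning
  m = length x
  ℓ : length (reverse x) ≡ m
  ℓ = Listₚ.length-reverse x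
  k<m : k < m
  k<m = subst (k <_) ℓ k<

-- The orbit of a tuple without symmetries has no repeated entries: the
-- rotations of x are distinct, so are those of reverse x, and a coincidence
-- between the two halves is a reflection symmetry.
orbit-unique : ∀ x → 0 < length x → ¬ Symmetric x → Unique (orbit x)
orbit-unique x pos asym = Uniqueₚ.++⁺ (distinct-rotations x (asym ∘ inj₁))
  (subst (λ l → Unique (map (λ k → rotate k (reverse x)) (upTo l))) ℓ
         (distinct-rotations (reverse x) (asym ∘ inj₁ ∘ RotSymmetric-reverse x)))
  disjoint
  where
  m = length x
  ℓ : length (reverse x) ≡ m
  ℓ = Listₚ.length-reverse x
  distinct-rotations : ∀ y → ¬ RotSymmetric y → Unique (map (λ k → rotate k y) (upTo (length y)))
  distinct-rotations y ¬sym = subst Unique (sym (Listₚ.map-upTo _ (length y)))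
    (Uniqueₚ.applyUpTo⁺₁ _ (length y) (λ i<j j< eq → ¬sym (equal-rotations⇒RotSymmetric y _ _ i<j j< eq)))
  disjoint : ∀ {v} → ¬ (v ∈ map (λ k → rotate k x) (upTo m) × v ∈ map (λ k → rotate k (reverse x)) (upTo m))
  disjoint (v∈₁ , v∈₂) with ∈-map⁻ (λ k → rotate k x) v∈₁ | ∈-map⁻ (λ k → rotate k (reverse x)) v∈₂
  ... | i , i∈ , refl | j , j∈ , eq with rotate-rotate-Rot (m ∸ i) j (reverse x) (subst (0 <_) (sym ℓ) pos)
                                        (subst (m ∸ i ≤_) (sym ℓ) (m∸n≤m m i)) (subst (j ≤_) (sym ℓ) (<⇒≤ (∈-upTo⁻ j∈)))
  ...   | c , c< , eq′ = asym (inj₂ (c , subst (c <_) ℓ c< , sym (begin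
    x                                          ≡⟨ rotate-back i x (<⇒≤ (∈-upTo⁻ i∈)) ⟨
    rotate (m ∸ i) (rotate i x)                ≡⟨ cong (rotate (m ∸ i)) eq ⟩
    rotate (m ∸ i) (rotate j (reverse x))      ≡⟨ eq′ ⟩
    rotate c (reverse x)                       ∎)))
    where open ≡-Reasoning

module _ {A : Set} where

  -- Lists commuting with a non-empty list u are determined by their length:
  -- both are proper prefixes of u, or both start with u and what remains
  -- again commutes with u.  The recursion is on a bound N for the length.
  commuting-unique : ∀ (u B B′ : List A) → 0 < length u → length B ≡ length B′ →
                     B ++ u ≡ u ++ B → B′ ++ u ≡ u ++ B′ → B ≡ B′
  commuting-unique u B B′ = go (length B) B B′ ≤-refl
    where
    prefix : ∀ X → length u ≤ length X → X ++ u ≡ u ++ X → take (length u) X ≡ u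
    prefix X u≤ comm = trans (sym (take-++ˡ (length u) X u u≤)) (trans (cong (take (length u)) comm) (take-length-++ u X))
    rest-commutes : ∀ X → length u ≤ length X → X ++ u ≡ u ++ X →
                    drop (length u) X ++ u ≡ u ++ drop (length u) X
    rest-commutes X u≤ comm = Listₚ.++-cancelˡ u _ _ (begin
      u ++ (Y ++ u)     ≡⟨ Listₚ.++-assoc u Y u ⟨
      (u ++ Y) ++ u     ≡⟨ cong (_++ u) split ⟩
      X ++ u            ≡⟨ comm ⟩
      u ++ X            ≡⟨ cong (u ++_) split ⟨
      u ++ (u ++ Y)     ∎)
      where
      open ≡-Reasoning
      Y = drop (length u) X
      split : u ++ Y ≡ X
      split = trans (cong (_++ Y) (sym (prefix X u≤ comm))) (Listₚ.take++drop≡id (length u) X)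
    go : ∀ N B B′ → length B ≤ N → 0 < length u → length B ≡ length B′ →
         B ++ u ≡ u ++ B → B′ ++ u ≡ u ++ B′ → B ≡ B′
    go N B B′ B≤N pos ℓ comm comm′ with length u ≤? length B
    ... | no u≰B = begin
      B                      ≡⟨ take-length-++ B u ⟨
      take (length B) (B ++ u)   ≡⟨ cong (take (length B)) comm ⟩
      take (length B) (u ++ B)   ≡⟨ take-++ˡ (length B) u B B≤u ⟩
      take (length B) u          ≡⟨ cong (λ l → take l u) ℓ ⟩
      take (length B′) u         ≡⟨ take-++ˡ (length B′) u B′ (subst (_≤ length u) ℓ B≤u) ⟨
      take (length B′) (u ++ B′) ≡⟨ cong (take (length B′)) comm′ ⟨
      take (length B′) (B′ ++ u) ≡⟨ take-length-++ B′ u ⟩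
      B′                     ∎
      where
      open ≡-Reasoning
      B≤u = <⇒≤ (≰⇒> u≰B)
    go zero    B B′ B≤N pos ℓ comm comm′ | yes u≤B = ⊥-elim (<-irrefl refl (<-≤-trans pos (≤-trans u≤B B≤N)))
    go (suc N) B B′ B≤N pos ℓ comm comm′ | yes u≤B = begin
      B                          ≡⟨ Listₚ.take++drop≡id (length u) B ⟨
      take (length u) B ++ R     ≡⟨ cong₂ _++_ (prefix B u≤B comm) R≡R′ ⟩
      u ++ R′                    ≡⟨ cong (_++ R′) (prefix B′ u≤B′ comm′) ⟨
      take (length u) B′ ++ R′   ≡⟨ Listₚ.take++drop≡id (length u) B′ ⟩
      B′                         ∎
      where
      open ≡-Reasoning
      u≤B′ = subst (length u ≤_) ℓ u≤B
      R = drop (length u) B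
      R′ = drop (length u) B′
      R≤N : length R ≤ N
      R≤N = subst (_≤ N) (sym (Listₚ.length-drop (length u) B)) (≤-trans (∸-monoʳ-≤ (length B) pos) (∸-monoˡ-≤ 1 B≤N))
      R≡R′ : R ≡ R′
      R≡R′ = go N R R′ R≤N pos
        (trans (Listₚ.length-drop (length u) B) (trans (cong (_∸ length u) ℓ) (sym (Listₚ.length-drop (length u) B′))))
        (rest-commutes B u≤B comm) (rest-commutes B′ u≤B′ comm′)

  drop-reverse : ∀ (X : List A) h → h ≤ length X → drop (length X ∸ h) (reverse X) ≡ reverse (take h X)
  drop-reverse X h h≤ = begin
    drop (length X ∸ h) (reverse X)
      ≡⟨ cong (drop (length X ∸ h) ∘ reverse) (Listₚ.take++drop≡id h X) ⟨
    drop (length X ∸ h) (reverse (take h X ++ drop h X))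
      ≡⟨ cong (drop (length X ∸ h)) (Listₚ.reverse-++ (take h X) (drop h X)) ⟩
    drop (length X ∸ h) (reverse (drop h X) ++ reverse (take h X))
      ≡⟨ cong (λ l → drop l (reverse (drop h X) ++ reverse (take h X)))
              (trans (Listₚ.length-reverse (drop h X)) (Listₚ.length-drop h X)) ⟨
    drop (length (reverse (drop h X))) (reverse (drop h X) ++ reverse (take h X))
      ≡⟨ drop-length-++ (reverse (drop h X)) (reverse (take h X)) ⟩
    reverse (take h X)
      ∎
    where open ≡-Reasoning

  palindrome-split : ∀ (X : List A) h → X ≡ reverse X → 2 * h ≤ length X →
                     X ≡ take h X ++ take (length X ∸ 2 * h) (drop h X) ++ reverse (take h X)
  palindrome-split X h pal 2h≤ = begin
    X
      ≡⟨ Listₚ.take++drop≡id h X ⟨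
    take h X ++ drop h X
      ≡⟨ cong (take h X ++_) (Listₚ.take++drop≡id (j ∸ 2 * h) (drop h X)) ⟨
    take h X ++ take (j ∸ 2 * h) (drop h X) ++ drop (j ∸ 2 * h) (drop h X)
      ≡⟨ cong (λ z → take h X ++ take (j ∸ 2 * h) (drop h X) ++ z) tail ⟩
    take h X ++ take (j ∸ 2 * h) (drop h X) ++ reverse (take h X)
      ∎
    where
    open ≡-Reasoning
    j = length X
    h≤j∸h : h ≤ j ∸ h
    h≤j∸h = m+n≤o⇒m≤o∸n h (subst (_≤ j) (cong (h +_) (+-identityʳ h)) 2h≤)
    h≤j : h ≤ j
    h≤j = ≤-trans (m≤m+n h (h + 0)) 2h≤
    offset : h + (j ∸ 2 * h) ≡ j ∸ h
    offset = begin
      h + (j ∸ 2 * h)      ≡⟨ cong (λ z → h + (j ∸ z)) (cong (h +_) (+-identityʳ h)) ⟩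
      h + (j ∸ (h + h))    ≡⟨ cong (h +_) (∸-+-assoc j h h) ⟨
      h + (j ∸ h ∸ h)      ≡⟨ m+[n∸m]≡n h≤j∸h ⟩
      j ∸ h                ∎
    tail : drop (j ∸ 2 * h) (drop h X) ≡ reverse (take h X)
    tail = begin
      drop (j ∸ 2 * h) (drop h X)   ≡⟨ Listₚ.drop-drop h (j ∸ 2 * h) X ⟩
      drop (h + (j ∸ 2 * h)) X      ≡⟨ cong (λ l → drop l X) offset ⟩
      drop (j ∸ h) X                ≡⟨ cong (drop (j ∸ h)) pal ⟩
      drop (j ∸ h) (reverse X)      ≡⟨ drop-reverse X h h≤j ⟩
      reverse (take h X)            ∎

sum-take-≤ : ∀ k (x : List ℕ) → sum (take k x) ≤ sum x
sum-take-≤ k x = subst (sum (take k x) ≤_) (trans (sym (sum-++ (take k x) (drop k x))) (cong sum (Listₚ.take++drop≡id k x))) (m≤m+n _ _)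

palindrome-sum : ∀ (X : List ℕ) h → X ≡ reverse X → 2 * h ≤ length X → 2 * sum (take h X) ≤ sum X
palindrome-sum X h pal 2h≤ = subst (2 * sum t ≤_) (sym (cong sum (palindrome-split X h pal 2h≤))) (begin
  2 * sum t                      ≡⟨ cong (sum t +_) (+-identityʳ (sum t)) ⟩
  sum t + sum t                  ≤⟨ +-monoʳ-≤ (sum t) (m≤n+m (sum t) (sum mid)) ⟩
  sum t + (sum mid + sum t)      ≡⟨ cong (λ z → sum t + (sum mid + z)) (sum-↭ (↭-reverse t)) ⟨
  sum t + (sum mid + sum (reverse t)) ≡⟨ cong (sum t +_) (sum-++ mid (reverse t)) ⟨
  sum t + sum (mid ++ reverse t) ≡⟨ sum-++ t (mid ++ reverse t) ⟨
  sum (t ++ mid ++ reverse t)    ∎)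
  where
  open ≤-Reasoning
  t = take h X
  mid = take (length X ∸ 2 * h) (drop h X)

reflection⇒palindromes : ∀ k (d : List ℕ) → k ≤ length d → rotate k (reverse d) ≡ d →
  let j = length d ∸ k in take j d ≡ reverse (take j d) × drop j d ≡ reverse (drop j d)
reflection⇒palindromes k d k≤ refl-sym =
  ++-cancel-length X Y (reverse X) (reverse Y) (sym (Listₚ.length-reverse X))
    (trans (Listₚ.take++drop≡id j d) (trans (sym refl-sym) rotated))
  where
  open ≡-Reasoning
  j = length d ∸ k
  X = take j d
  Y = drop j d
  rotated : rotate k (reverse d) ≡ reverse X ++ reverse Y
  rotated = begin
    rotate k (reverse d)                  ≡⟨ cong (rotate k ∘ reverse) (Listₚ.take++drop≡id j d) ⟨
    rotate k (reverse (X ++ Y))           ≡⟨ cong (rotate k) (Listₚ.reverse-++ X Y) ⟩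
    rotate k (reverse Y ++ reverse X)     ≡⟨ cong (λ l → rotate l (reverse Y ++ reverse X)) ℓ ⟨
    rotate (length (reverse Y)) (reverse Y ++ reverse X)
      ≡⟨ cong₂ _++_ (drop-length-++ (reverse Y) (reverse X)) (take-length-++ (reverse Y) (reverse X)) ⟩
    reverse X ++ reverse Y                ∎
    where
    ℓ : length (reverse Y) ≡ k
    ℓ = trans (Listₚ.length-reverse Y) (trans (Listₚ.length-drop j d) (m∸[m∸n]≡n k≤))

2*≤⇒≤⌊/2⌋ : ∀ a n → 2 * a ≤ n → a ≤ ⌊ n /2⌋
2*≤⇒≤⌊/2⌋ a n 2a≤ = subst (_≤ ⌊ n /2⌋) (sym (trans (n≡⌊n+n/2⌋ a) (cong (λ z → ⌊ a + z /2⌋) (sym (+-identityʳ a))))) (⌊n/2⌋-mono 2a≤)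

⌊/2⌋-bounds : ∀ j → 2 * ⌊ j /2⌋ ≤ j × j ≤ 2 * ⌊ j /2⌋ + 1
⌊/2⌋-bounds zero          = z≤n , z≤n
⌊/2⌋-bounds (suc zero)    = z≤n , s≤s z≤n
⌊/2⌋-bounds (suc (suc j)) with ⌊/2⌋-bounds j
... | lower , upper = subst (_≤ suc (suc j)) (sym (2[1+x] ⌊ j /2⌋)) (s≤s (s≤s lower))
                    , subst (suc (suc j) ≤_) (sym (cong (_+ 1) (2[1+x] ⌊ j /2⌋))) (s≤s (s≤s upper))
  where
  2[1+x] : ∀ x → 2 * suc x ≡ suc (suc (2 * x))
  2[1+x] = solve-∀

length-cartesianProduct : {A B : Set} (xs : List A) (ys : List B) →
                          length (cartesianProduct xs ys) ≡ length xs * length ys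
length-cartesianProduct []       ys = refl
length-cartesianProduct (x ∷ xs) ys =
  trans (Listₚ.length-++ (map (x ,_) ys)) (cong₂ _+_ (Listₚ.length-map (x ,_) ys) (length-cartesianProduct xs ys))

-- Exceptional tuples of perimeter n are encoded by short keys.  The basic
-- ingredients are numbers ≤ n and compositions of numbers ≤ n/2; there are
-- only 2^⌊n/2⌋ of the latter.
SmallKey : Set
SmallKey = ℕ × ℕ × List ℕ

smallKeys : ℕ → List SmallKey
smallKeys n = cartesianProduct (upTo (suc n)) (cartesianProduct (upTo (suc n)) (compositionsUpTo ⌊ n /2⌋))

length-smallKeys : ∀ n → length (smallKeys n) ≡ suc n * (suc n * 2 ^ ⌊ n /2⌋)
length-smallKeys n = begin
  length (smallKeys n)
    ≡⟨ length-cartesianProduct (upTo (suc n)) (cartesianProduct (upTo (suc n)) (compositionsUpTo ⌊ n /2⌋)) ⟩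
  length (upTo (suc n)) * length (cartesianProduct (upTo (suc n)) (compositionsUpTo ⌊ n /2⌋))
    ≡⟨ cong₂ _*_ (Listₚ.length-upTo (suc n)) (length-cartesianProduct (upTo (suc n)) (compositionsUpTo ⌊ n /2⌋)) ⟩
  suc n * (length (upTo (suc n)) * length (compositionsUpTo ⌊ n /2⌋))
    ≡⟨ cong (suc n *_) (cong₂ _*_ (Listₚ.length-upTo (suc n)) (length-compositionsUpTo ⌊ n /2⌋)) ⟩
  suc n * (suc n * 2 ^ ⌊ n /2⌋)
    ∎
  where open ≡-Reasoning

∈-compositionsUpTo-half : ∀ n u → Positive u → 2 * sum u ≤ n → u ∈ compositionsUpTo ⌊ n /2⌋
∈-compositionsUpTo-half n u pu 2u≤ = ∈-compositionsUpTo ⌊ n /2⌋ u pu (2*≤⇒≤⌊/2⌋ (sum u) n 2u≤)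

∈-smallKeys : ∀ {n i a u} → i ≤ n → a ≤ n → Positive u → 2 * sum u ≤ n → (i , a , u) ∈ smallKeys n
∈-smallKeys {n} {u = u} i≤ a≤ pu 2u≤ =
  ∈-cartesianProduct⁺ (∈-upTo⁺ (s≤s i≤)) (∈-cartesianProduct⁺ (∈-upTo⁺ (s≤s a≤)) (∈-compositionsUpTo-half n u pu 2u≤))

-- The middle of an odd palindrome: lists of length at most one, entries ≤ n.
middles : ℕ → List (List ℕ)
middles n = [] ∷ map (_∷ []) (upTo (suc n))

length-middles : ∀ n → length (middles n) ≡ suc (suc n)
length-middles n = cong suc (trans (Listₚ.length-map (_∷ []) (upTo (suc n))) (Listₚ.length-upTo (suc n)))

∈-middles : ∀ n a → length a ≤ 1 → All (_≤ n) a → a ∈ middles n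
∈-middles n []          _         _          = here refl
∈-middles n (e ∷ [])    _         (e≤ ∷ []) = there (∈-map⁺ (_∷ []) (∈-upTo⁺ (s≤s e≤)))
∈-middles n (e ∷ f ∷ a) (s≤s ()) _

firstHalf : List ℕ → List ℕ
firstHalf X = take ⌊ length X /2⌋ X

middle : List ℕ → List ℕ
middle X = take (length X ∸ 2 * ⌊ length X /2⌋) (drop ⌊ length X /2⌋ X)

palindrome-halves : ∀ X → X ≡ reverse X → X ≡ firstHalf X ++ middle X ++ reverse (firstHalf X)
palindrome-halves X pal = palindrome-split X ⌊ length X /2⌋ pal (proj₁ (⌊/2⌋-bounds (length X)))

firstHalf-sum : ∀ X → X ≡ reverse X → 2 * sum (firstHalf X) ≤ sum X
firstHalf-sum X pal = palindrome-sum X ⌊ length X /2⌋ pal (proj₁ (⌊/2⌋-bounds (length X)))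

length-firstHalf : ∀ X → length (firstHalf X) ≡ ⌊ length X /2⌋
length-firstHalf X = length-take-≤ ⌊ length X /2⌋ X (⌊n/2⌋≤n (length X))

-- A middle has at most one entry, as the length is 2⌊j/2⌋ or 2⌊j/2⌋ + 1.
length-middle : ∀ X → length (middle X) ≤ 1
length-middle X = begin
  length (middle X)                   ≡⟨ Listₚ.length-take (length X ∸ 2 * h) _ ⟩
  (length X ∸ 2 * h) ⊓ _              ≤⟨ m⊓n≤m _ _ ⟩
  length X ∸ 2 * h                    ≤⟨ ∸-monoˡ-≤ (2 * h) (proj₂ (⌊/2⌋-bounds (length X))) ⟩
  2 * h + 1 ∸ 2 * h                   ≡⟨ m+n∸m≡n (2 * h) 1 ⟩
  1                                   ∎
  where
  open ≤-Reasoning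
  h = ⌊ length X /2⌋

-- Reflection-symmetric tuples are two palindromes A ++ B; they are encoded
-- by |A|, the concatenated first halves, and the two middles.
ReflKey : Set
ReflKey = ℕ × List ℕ × List ℕ × List ℕ

reflKeys : ℕ → List ReflKey
reflKeys n = cartesianProduct (upTo (suc n))
               (cartesianProduct (compositionsUpTo ⌊ n /2⌋) (cartesianProduct (middles n) (middles n)))

length-reflKeys : ∀ n → length (reflKeys n) ≡ suc n * (2 ^ ⌊ n /2⌋ * (suc (suc n) * suc (suc n)))
length-reflKeys n = begin
  length (reflKeys n)
    ≡⟨ length-cartesianProduct (upTo (suc n)) (cartesianProduct (compositionsUpTo h) M²) ⟩
  length (upTo (suc n)) * length (cartesianProduct (compositionsUpTo h) M²)
    ≡⟨ cong₂ _*_ (Listₚ.length-upTo (suc n)) (length-cartesianProduct (compositionsUpTo h) M²) ⟩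
  suc n * (length (compositionsUpTo h) * length M²)
    ≡⟨ cong (suc n *_) (cong₂ _*_ (length-compositionsUpTo h) (length-cartesianProduct (middles n) (middles n))) ⟩
  suc n * (2 ^ h * (length (middles n) * length (middles n)))
    ≡⟨ cong (λ z → suc n * (2 ^ h * (z * z))) (length-middles n) ⟩
  suc n * (2 ^ h * (suc (suc n) * suc (suc n)))
    ∎
  where
  open ≡-Reasoning
  h = ⌊ n /2⌋
  M² = cartesianProduct (middles n) (middles n)

decodeReflection : ReflKey → List ℕ
decodeReflection (j , u , a , b) = (t ++ a ++ reverse t) ++ (t′ ++ b ++ reverse t′)
  where
  t  = take ⌊ j /2⌋ u
  t′ = drop ⌊ j /2⌋ u

-- Keys for symmetric tuples: a rotational symmetry by k of a tuple d of
-- length m is recorded as (k , m , take k d); a reflection symmetry by a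
-- reflection key.
SymKey : Set
SymKey = SmallKey ⊎ ReflKey

symKeys : ℕ → List SymKey
symKeys n = map inj₁ (smallKeys n) ++ map inj₂ (reflKeys n)

length-symKeys : ∀ n → length (symKeys n) ≡ length (smallKeys n) + length (reflKeys n)
length-symKeys n = trans (Listₚ.length-++ (map inj₁ (smallKeys n)))
  (cong₂ _+_ (Listₚ.length-map inj₁ (smallKeys n)) (Listₚ.length-map inj₂ (reflKeys n)))

_≟-SymKey_ : DecidableEquality SymKey
_≟-SymKey_ = Sumₚ.≡-dec (Productₚ.≡-dec _≟_ (Productₚ.≡-dec _≟_ ≡-dec-List))
                        (Productₚ.≡-dec _≟_ (Productₚ.≡-dec ≡-dec-List (Productₚ.≡-dec ≡-dec-List ≡-dec-List)))
  where
  ≡-dec-List = Listₚ.≡-dec _≟_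

Encodes : List ℕ → SymKey → Set
Encodes d (inj₁ (k , m , u)) = length d ≡ m × 0 < k × k ≤ m × u ≡ take k d × rotate k d ≡ d
Encodes d (inj₂ key)         = d ≡ decodeReflection key

-- A key encodes at most one tuple.  For a rotation key, d = u ++ drop k d
-- where drop k d commutes with u and has length m ∸ k.
Encodes-injective : ∀ {d d′ key} → Encodes d key → Encodes d′ key → d ≡ d′
Encodes-injective {key = inj₂ _} eq eq′ = trans eq (sym eq′)
Encodes-injective {d} {d′} {inj₁ (k , m , _)} (ℓ , k>0 , k≤m , refl , rot) (ℓ′ , _ , _ , u≡ , rot′) = begin
  d                        ≡⟨ Listₚ.take++drop≡id k d ⟨
  take k d ++ drop k d     ≡⟨ cong₂ _++_ u≡ rest ⟩
  take k d′ ++ drop k d′   ≡⟨ Listₚ.take++drop≡id k d′ ⟩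
  d′                       ∎
  where
  open ≡-Reasoning
  commutes : ∀ x → rotate k x ≡ x → drop k x ++ take k x ≡ take k x ++ drop k x
  commutes x rot = trans rot (sym (Listₚ.take++drop≡id k x))
  rest : drop k d ≡ drop k d′
  rest = commuting-unique (take k d) (drop k d) (drop k d′)
    (subst (0 <_) (sym (length-take-≤ k d (subst (k ≤_) (sym ℓ) k≤m))) k>0)
    (trans (Listₚ.length-drop k d) (trans (cong (_∸ k) (trans ℓ (sym ℓ′))) (sym (Listₚ.length-drop k d′))))
    (commutes d rot)
    (subst (λ z → drop k d′ ++ z ≡ z ++ drop k d′) (sym u≡) (commutes d′ rot′))

Polygon-sum : ∀ {n d} → Polygon n d → sum d ≡ n
Polygon-sum ((_ , sum≡ , _) , _) = sum≡

Polygon-entries≤ : ∀ {n d} → Polygon n d → All (_≤ n) d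
Polygon-entries≤ {d = d} p = subst (λ z → All (_≤ z) d) (Polygon-sum p) (All-≤-sum d)

smaller-part : ∀ {a b n} → a ≤ b → a + b ≡ n → 2 * a ≤ n
smaller-part {a} {b} a≤b refl = subst (_≤ a + b) (cong (a +_) (sym (+-identityʳ a))) (+-monoʳ-≤ a a≤b)

-- A rotational symmetry by k with 2k ≤ length d: the first k entries u
-- reappear right after themselves, so they carry at most half the sum.
rotation-key : ∀ {n d k} → Polygon n d → 0 < k → 2 * k ≤ length d → rotate k d ≡ d →
               Σ SymKey (λ key → key ∈ symKeys n × Encodes d key)
rotation-key {n} {d} {k} pd k>0 2k≤ rot =
  inj₁ (k , length d , u) ,
  ∈-++⁺ˡ (∈-map⁺ inj₁ (∈-smallKeys (≤-trans k≤m m≤n) m≤n (Allₚ.take⁺ k (proj₂ pd)) (smaller-part u≤B u+B))) ,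
  refl , k>0 , k≤m , refl , rot
  where
  m = length d
  m≤n = Polygon-length≤ pd
  k≤m : k ≤ m
  k≤m = ≤-trans (m≤m+n k (k + 0)) 2k≤
  u = take k d
  B = drop k d
  k≤B : k ≤ length B
  k≤B = subst (k ≤_) (sym (Listₚ.length-drop k d)) (m+n≤o⇒m≤o∸n k (subst (_≤ m) (cong (k +_) (+-identityʳ k)) 2k≤))
  u-again : take k B ≡ u
  u-again = begin
    take k B              ≡⟨ take-++ˡ k B u k≤B ⟨
    take k (B ++ u)       ≡⟨ cong (take k) (trans rot (sym (Listₚ.take++drop≡id k d))) ⟩
    take k (u ++ B)       ≡⟨ cong (λ l → take l (u ++ B)) (length-take-≤ k d k≤m) ⟨
    take (length u) (u ++ B) ≡⟨ take-length-++ u B ⟩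
    u                     ∎
    where open ≡-Reasoning
  u≤B : sum u ≤ sum B
  u≤B = subst (λ z → sum z ≤ sum B) u-again (sum-take-≤ k B)
  u+B : sum u + sum B ≡ n
  u+B = trans (sym (sum-++ u B)) (trans (cong sum (Listₚ.take++drop≡id k d)) (Polygon-sum pd))

RotSymmetric-key : ∀ {n d} → Polygon n d → RotSymmetric d → Σ SymKey (λ key → key ∈ symKeys n × Encodes d key)
RotSymmetric-key {n} {d} pd (k , k<m , k>0 , rot) with 2 * k ≤? length d
... | yes 2k≤ = rotation-key pd k>0 2k≤ rot
... | no  2k≰ = rotation-key pd (m<n⇒0<n∸m k<m) 2r≤ rot′
  where
  m = length d
  r = m ∸ k
  rot′ : rotate r d ≡ d
  rot′ = trans (cong (rotate r) (sym rot)) (rotate-back k d (<⇒≤ k<m))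
  r+k : r + k ≡ m
  r+k = m∸n+n≡m (<⇒≤ k<m)
  r<k : r < k
  r<k = +-cancelʳ-< k r k (subst (_< k + k) (sym r+k) (subst (m <_) (cong (k +_) (+-identityʳ k)) (≰⇒> 2k≰)))
  2r≤ : 2 * r ≤ m
  2r≤ = smaller-part (<⇒≤ r<k) r+k

reflection-key : ∀ {n d} → Polygon n d → ReflSymmetric d → Σ SymKey (λ key → key ∈ symKeys n × Encodes d key)
reflection-key {n} {d} pd (k , k< , refl-sym) =
  inj₂ (j , u , middle A , middle B) ,
  ∈-++⁺ʳ (map inj₁ (smallKeys n))
    (∈-map⁺ inj₂ (∈-cartesianProduct⁺ (∈-upTo⁺ (s≤s (≤-trans (m∸n≤m m k) (Polygon-length≤ pd))))
      (∈-cartesianProduct⁺ (∈-compositionsUpTo-half n u pu 2u≤)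
        (∈-cartesianProduct⁺ (∈-middles n (middle A) (length-middle A) (middle≤ A (Allₚ.take⁺ j entries≤)))
                             (∈-middles n (middle B) (length-middle B) (middle≤ B (Allₚ.drop⁺ j entries≤))))))) ,
  decoded
  where
  m = length d
  j = m ∸ k
  A = take j d
  B = drop j d
  palindromes = reflection⇒palindromes k d (<⇒≤ k<) refl-sym
  u = firstHalf A ++ firstHalf B
  entries≤ = Polygon-entries≤ pd
  middle≤ : ∀ X → All (_≤ n) X → All (_≤ n) (middle X)
  middle≤ X all = Allₚ.take⁺ (length X ∸ 2 * ⌊ length X /2⌋) (Allₚ.drop⁺ ⌊ length X /2⌋ all)
  pu : Positive u
  pu = Allₚ.++⁺ (Allₚ.take⁺ ⌊ length A /2⌋ (Allₚ.take⁺ j (proj₂ pd))) (Allₚ.take⁺ ⌊ length B /2⌋ (Allₚ.drop⁺ j (proj₂ pd)))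
  2u≤ : 2 * sum u ≤ n
  2u≤ = begin
    2 * sum u                                      ≡⟨ cong (2 *_) (sum-++ (firstHalf A) (firstHalf B)) ⟩
    2 * (sum (firstHalf A) + sum (firstHalf B))    ≡⟨ *-distribˡ-+ 2 (sum (firstHalf A)) _ ⟩
    2 * sum (firstHalf A) + 2 * sum (firstHalf B)  ≤⟨ +-mono-≤ (firstHalf-sum A (proj₁ palindromes)) (firstHalf-sum B (proj₂ palindromes)) ⟩
    sum A + sum B                                  ≡⟨ sum-++ A B ⟨
    sum (A ++ B)                                   ≡⟨ cong sum (Listₚ.take++drop≡id j d) ⟩
    sum d                                          ≡⟨ Polygon-sum pd ⟩
    n                                              ∎
    where open ≤-Reasoning
  ⌊j/2⌋≡ : length (firstHalf A) ≡ ⌊ j /2⌋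
  ⌊j/2⌋≡ = trans (length-firstHalf A) (cong ⌊_/2⌋ (length-take-≤ j d (m∸n≤m m k)))
  halves : take ⌊ j /2⌋ u ≡ firstHalf A × drop ⌊ j /2⌋ u ≡ firstHalf B
  halves = subst (λ l → take l u ≡ firstHalf A × drop l u ≡ firstHalf B) ⌊j/2⌋≡
                 (take-length-++ (firstHalf A) (firstHalf B) , drop-length-++ (firstHalf A) (firstHalf B))
  decoded : d ≡ decodeReflection (j , u , middle A , middle B)
  decoded = begin
    d
      ≡⟨ Listₚ.take++drop≡id j d ⟨
    A ++ B
      ≡⟨ cong₂ _++_ (palindrome-halves A (proj₁ palindromes)) (palindrome-halves B (proj₂ palindromes)) ⟩
    (firstHalf A ++ middle A ++ reverse (firstHalf A)) ++ (firstHalf B ++ middle B ++ reverse (firstHalf B))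
      ≡⟨ cong₂ (λ t t′ → (t ++ middle A ++ reverse t) ++ (t′ ++ middle B ++ reverse t′)) (proj₁ halves) (proj₂ halves) ⟨
    decodeReflection (j , u , middle A , middle B)
      ∎
    where open ≡-Reasoning

symmetric-key : ∀ {n d} → Polygon n d → Symmetric d → Σ SymKey (λ key → key ∈ symKeys n × Encodes d key)
symmetric-key pd (inj₁ rot-sym)  = RotSymmetric-key pd rot-sym
symmetric-key pd (inj₂ refl-sym) = reflection-key pd refl-sym

short-large-entry : ∀ a x → length x ≤ 1 → Any (λ b → sum (a ∷ x) ≤ 2 * b) (a ∷ x)
short-large-entry a []       _ = here (+-monoʳ-≤ a z≤n)
short-large-entry a (b ∷ []) _ with b ≤? a
... | yes b≤a = here (+-monoʳ-≤ a (+-monoˡ-≤ 0 b≤a))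
... | no  b≰a = there (here (+-monoˡ-≤ (b + 0) (<⇒≤ (≰⇒> b≰a))))
short-large-entry a (b ∷ c ∷ x) (s≤s ())

-- A composition of N > 0 that is not a polygon tuple has an entry a with
-- N ≤ 2a: it has fewer than three parts, or some part violates 2a < N.
non-polygon-large-entry : ∀ n x → sum x ≡ suc n → ¬ IsPolygonTuple (suc n) x → Any (λ a → suc n ≤ 2 * a) x
non-polygon-large-entry n x sum≡ ¬polygon with 3 ≤? length x
... | yes 3≤ = Any.map ≮⇒≥ (¬All⇒Any¬ (λ a → suc (2 * a) ≤? suc n) x (λ small → ¬polygon (3≤ , sum≡ , small)))
... | no  3≰ with x
...   | []    with () ← sum≡
...   | a ∷ y = subst (λ N → Any (λ b → N ≤ 2 * b) (a ∷ y)) sum≡ (short-large-entry a y (s≤s⁻¹ (s≤s⁻¹ (≰⇒> 3≰))))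

Inserted : List ℕ → SmallKey → Set
Inserted x (i , a , w) = x ≡ take i w ++ a ∷ drop i w

-- A non-polygon composition of N = n+1 is encoded by the position i and
-- value a of a large entry together with the remaining entries w, which sum
-- to at most N/2.
large-entry-key : ∀ n x → Positive x → sum x ≡ suc n → ¬ IsPolygonTuple (suc n) x →
                  Σ SmallKey (λ key → key ∈ smallKeys (suc n) × Inserted x key)
large-entry-key n x px sum≡ ¬polygon
  with a , a∈ , large ← find (non-polygon-large-entry n x sum≡ ¬polygon)
  with u , v , refl ← ∈-∃++ a∈ =
  (length u , a , u ++ v) , ∈-smallKeys i≤ a≤ pw 2w≤ ,
  sym (cong₂ (λ p q → p ++ a ∷ q) (take-length-++ u v) (drop-length-++ u v))
  where
  N = suc n
  x≡ : sum u + (a + sum v) ≡ N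
  x≡ = trans (sym (sum-++ u (a ∷ v))) sum≡
  i≤ : length u ≤ N
  i≤ = ≤-trans (≤-trans (m≤m+n (length u) _) (≤-reflexive (sym (Listₚ.length-++ u))))
               (subst (length (u ++ a ∷ v) ≤_) sum≡ (length≤sum (u ++ a ∷ v) px))
  a≤ : a ≤ N
  a≤ = subst (a ≤_) x≡ (≤-trans (m≤m+n a (sum v)) (m≤n+m (a + sum v) (sum u)))
  pw : Positive (u ++ v)
  pw = let pu , pav = Allₚ.++⁻ u px in Allₚ.++⁺ pu (All.tail pav)
  w+a : sum (u ++ v) + a ≡ N
  w+a = trans (cong (_+ a) (sum-++ u v)) (trans (x+y+z≡x+[z+y] (sum u) (sum v) a) x≡)
    where
    x+y+z≡x+[z+y] : ∀ x y z → x + y + z ≡ x + (z + y)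
    x+y+z≡x+[z+y] = solve-∀
  2w≤ : 2 * sum (u ++ v) ≤ N
  2w≤ = +-cancelʳ-≤ N (2 * w) N (begin
    2 * w + N        ≤⟨ +-monoʳ-≤ (2 * w) large ⟩
    2 * w + 2 * a    ≡⟨ *-distribˡ-+ 2 w a ⟨
    2 * (w + a)      ≡⟨ cong (2 *_) w+a ⟩
    2 * N            ≡⟨ cong (N +_) (+-identityʳ N) ⟩
    N + N            ∎)
    where
    open ≤-Reasoning
    w = sum (u ++ v)

orbit-nonempty : ∀ {a v} → v ∈ orbit a → 0 < length a
orbit-nonempty {_ ∷ _} _ = s≤s z≤n

orbits-disjoint : ∀ {a b} → ¬ (b ∈ orbit a) → Disjoint (orbit a) (orbit b)
orbits-disjoint {a} {b} b∉ (v∈a , v∈b) =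
  b∉ (Orb⇒∈-orbit (Orb-trans (orbit-nonempty {a} v∈a) (∈-orbit⇒Orb {a} v∈a) (Orb-sym (orbit-nonempty {b} v∈b) (∈-orbit⇒Orb {b} v∈b))))

inequivalent⇒unique : ∀ {xs} → All (λ a → 0 < length a) xs → AllPairs (λ a b → ¬ (b ∈ orbit a)) xs → Unique xs
inequivalent⇒unique []         []           = []
inequivalent⇒unique (a>0 ∷ ps) (b∉s ∷ rest) =
  All.map (λ { b∉ refl → b∉ (Orb⇒∈-orbit (Orb-refl _ a>0)) }) b∉s ∷ inequivalent⇒unique ps rest

module PerimeterBounds (s : ℕ) where

  n = suc s

  weight : List ℕ → ℕ
  weight x = factorialExcept n (length x)

  orbit-weight : ∀ {d} → Polygon n d → ∑ weight (orbit d) ≡ 2 * n !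
  orbit-weight {d} pd = begin
    ∑ weight (orbit d)               ≡⟨ ∑-cong (orbit d) (λ y∈ → cong (factorialExcept n) (Orb-length (∈-orbit⇒Orb {d} y∈))) ⟩
    ∑ (λ _ → weight d) (orbit d)     ≡⟨ ∑-const (weight d) (orbit d) ⟩
    weight d * length (orbit d)      ≡⟨ cong (weight d *_) (length-orbit d) ⟩
    weight d * (ℓ + ℓ)               ≡⟨ a*[b+b]≡2*[b*a] (weight d) ℓ ⟩
    2 * (ℓ * weight d)               ≡⟨ cong (2 *_) (factorialExcept-spec n ℓ (Polygon-length>0 pd) (Polygon-length≤ pd)) ⟩
    2 * n !                          ∎
    where
    open ≡-Reasoning
    ℓ = length d
    a*[b+b]≡2*[b*a] : ∀ a b → a * (b + b) ≡ 2 * (b * a)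
    a*[b+b]≡2*[b*a] = solve-∀

  orbits-weight : ∀ ds → All (Polygon n) ds → ∑ weight (concatMap orbit ds) ≡ 2 * n ! * length ds
  orbits-weight ds pds = begin
    ∑ weight (concatMap orbit ds)         ≡⟨ ∑-concatMap weight orbit ds ⟩
    ∑ (λ d → ∑ weight (orbit d)) ds       ≡⟨ ∑-cong ds (orbit-weight ∘ All.lookup pds) ⟩
    ∑ (λ _ → 2 * n !) ds                  ≡⟨ ∑-const (2 * n !) ds ⟩
    2 * n ! * length ds                   ∎
    where open ≡-Reasoning

  asymmetric symmetric : List (List ℕ)
  asymmetric = filter (¬? ∘ symmetric?) (classes n)
  symmetric  = filter symmetric? (classes n)

  polygonal nonPolygonal : List (List ℕ)
  polygonal    = filter (isPolygonTuple? n) (compositions s)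
  nonPolygonal = filter (¬? ∘ isPolygonTuple? n) (compositions s)

  ≡-dec-List = Listₚ.≡-dec _≟_

  classes-unique : Unique (classes n)
  classes-unique = inequivalent⇒unique (All.map Polygon-length>0 (classes-Polygon n)) (classes-inequivalent n)

  asymmetric-Polygon : All (Polygon n) asymmetric
  asymmetric-Polygon = Allₚ.filter⁺ (¬? ∘ symmetric?) (classes-Polygon n)

  asymmetric-orbits-unique : Unique (concatMap orbit asymmetric)
  asymmetric-orbits-unique = Uniqueₚ.concat⁺
    (Allₚ.map⁺ (All.tabulate λ d∈ →
      let d∈classes , ¬sym = ∈-filter⁻ (¬? ∘ symmetric?) {xs = classes n} d∈
      in orbit-unique _ (Polygon-length>0 (All.lookup (classes-Polygon n) d∈classes)) ¬sym))
    (AllPairsₚ.map⁺ {f = orbit} (AllPairs.map (λ {a} {b} → orbits-disjoint {a} {b}) (AllPairsₚ.filter⁺ (¬? ∘ symmetric?) (classes-inequivalent n))))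

  -- The orbits of asymmetric classes are distinct compositions of n.
  asymmetric-weight : 2 * n ! * length asymmetric ≤ ∑ weight (compositions s)
  asymmetric-weight = subst (_≤ ∑ weight (compositions s)) (orbits-weight asymmetric asymmetric-Polygon)
    (∑-mono-⊆ ≡-dec-List weight (concatMap orbit asymmetric) (compositions s) asymmetric-orbits-unique
      λ {x} x∈ → let d , d∈ , x∈orbit = find (∈-concatMap⁻ orbit {xs = asymmetric} x∈)
                     px = Polygon-Orb (∈-orbit⇒Orb x∈orbit) (All.lookup asymmetric-Polygon d∈)
                 in ∈-compositions⁺ s x (proj₂ px) (Polygon-sum px))

  -- Every polygon composition lies in the orbit of a class representative.
  polygonal-weight : ∑ weight polygonal ≤ 2 * n ! * p n
  polygonal-weight = subst (∑ weight polygonal ≤_) (orbits-weight (classes n) (classes-Polygon n))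
    (∑-mono-⊆ ≡-dec-List weight polygonal (concatMap orbit (classes n))
      (Uniqueₚ.filter⁺ (isPolygonTuple? n) (compositions-unique s))
      λ {x} x∈ → let x∈comp , isPolygon = ∈-filter⁻ (isPolygonTuple? n) {xs = compositions s} x∈
                     d , d∈ , d~x = classes-cover n (isPolygon , proj₁ (∈-compositions⁻ s x∈comp))
                 in ∈-concatMap⁺ orbit (lose d∈ (Orb⇒∈-orbit d~x)))

  nonPolygonal-weight : ∑ weight nonPolygonal ≤ n ! * length nonPolygonal
  nonPolygonal-weight = subst (∑ weight nonPolygonal ≤_) (∑-const (n !) nonPolygonal)
    (∑-mono nonPolygonal λ {x} x∈ →
      let x∈comp = proj₁ (∈-filter⁻ (¬? ∘ isPolygonTuple? n) {xs = compositions s} x∈)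
          px , sum≡ = ∈-compositions⁻ s x∈comp
      in factorialExcept-≤ n (length x) (length>0 x px sum≡) (subst (length x ≤_) sum≡ (length≤sum x px)))
    where
    length>0 : ∀ x → Positive x → sum x ≡ n → 0 < length x
    length>0 (_ ∷ _) _ _ = s≤s z≤n

  nonPolygonal-count : length nonPolygonal ≤ length (smallKeys n)
  nonPolygonal-count = length-≤-keys (Productₚ.≡-dec _≟_ (Productₚ.≡-dec _≟_ ≡-dec-List)) Inserted
    (λ {x} {x′} {key} → Inserted-injective {key = key})
    nonPolygonal (smallKeys n) (Uniqueₚ.filter⁺ (¬? ∘ isPolygonTuple? n) (compositions-unique s))
    λ {x} x∈ → let x∈comp , ¬polygon = ∈-filter⁻ (¬? ∘ isPolygonTuple? n) {xs = compositions s} x∈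
                   px , sum≡ = ∈-compositions⁻ s x∈comp
               in large-entry-key s x px sum≡ ¬polygon
    where
    Inserted-injective : ∀ {x x′ key} → Inserted x key → Inserted x′ key → x ≡ x′
    Inserted-injective {key = _ , _ , _} eq eq′ = trans eq (sym eq′)

  symmetric-count : length symmetric ≤ length (symKeys n)
  symmetric-count = length-≤-keys _≟-SymKey_ Encodes (λ {d} {d′} {key} → Encodes-injective {d} {d′} {key})
    symmetric (symKeys n) (Uniqueₚ.filter⁺ symmetric? classes-unique)
    λ {d} d∈ → let d∈classes , sym = ∈-filter⁻ symmetric? {xs = classes n} d∈
               in symmetric-key (All.lookup (classes-Polygon n) d∈classes) sym

  classes-split : length symmetric + length asymmetric ≡ p n
  classes-split = begin
    length symmetric + length asymmetric                    ≡⟨ cong₂ _+_ (∑-one symmetric) (∑-one asymmetric) ⟨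
    ∑ (λ _ → 1) symmetric + ∑ (λ _ → 1) asymmetric          ≡⟨ ∑-filter symmetric? (λ _ → 1) (classes n) ⟩
    ∑ (λ _ → 1) (classes n)                                 ≡⟨ ∑-one (classes n) ⟩
    p n                                                     ∎
    where open ≡-Reasoning

  instance
    n!≢0 : NonZero (n !)
    n!≢0 = n !≢0

  -- Dividing the weighted counts (composition-weights) by n!/n.
  asymmetric-bound : 2 * n * length asymmetric + 1 ≤ 2 ^ n
  asymmetric-bound = *-cancelˡ-≤ (n !) (begin
    n ! * (2 * n * length asymmetric + 1)            ≡⟨ rearrange n (n !) (length asymmetric) ⟨
    n * (2 * n ! * length asymmetric) + n !          ≤⟨ +-monoˡ-≤ (n !) (*-monoʳ-≤ n asymmetric-weight) ⟩
    n * ∑ weight (compositions s) + n !              ≡⟨ composition-weights s ⟩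
    n ! * 2 ^ n                                      ∎)
    where
    open ≤-Reasoning
    rearrange : ∀ a b c → a * (2 * b * c) + b ≡ b * (2 * a * c + 1)
    rearrange = solve-∀

  polygon-bound : 2 ^ n ≤ 2 * n * p n + n * length nonPolygonal + 1
  polygon-bound = *-cancelˡ-≤ (n !) (begin
    n ! * 2 ^ n                                                   ≡⟨ composition-weights s ⟨
    n * ∑ weight (compositions s) + n !                           ≡⟨ cong (λ z → n * z + n !) split ⟨
    n * (∑ weight polygonal + ∑ weight nonPolygonal) + n !
      ≤⟨ +-monoˡ-≤ (n !) (*-monoʳ-≤ n (+-mono-≤ polygonal-weight nonPolygonal-weight)) ⟩
    n * (2 * n ! * p n + n ! * length nonPolygonal) + n !         ≡⟨ rearrange n (n !) (p n) (length nonPolygonal) ⟩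
    n ! * (2 * n * p n + n * length nonPolygonal + 1)             ∎)
    where
    open ≤-Reasoning
    split = ∑-filter (isPolygonTuple? n) weight (compositions s)
    rearrange : ∀ a b c d → a * (2 * b * c + b * d) + b ≡ b * (2 * a * c + a * d + 1)
    rearrange = solve-∀

  -- p n = #symmetric + #asymmetric classes, and the symmetric ones are few.
  upper : 2 * n * p n + 1 ≤ 2 ^ n + 2 * n * length (symKeys n)
  upper = begin
    2 * n * p n + 1                                                ≡⟨ cong (λ z → 2 * n * z + 1) classes-split ⟨
    2 * n * (length symmetric + length asymmetric) + 1             ≡⟨ rearrange (2 * n) (length symmetric) (length asymmetric) ⟩
    (2 * n * length asymmetric + 1) + 2 * n * length symmetric     ≤⟨ +-mono-≤ asymmetric-bound (*-monoʳ-≤ (2 * n) symmetric-count) ⟩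
    2 ^ n + 2 * n * length (symKeys n)                             ∎
    where
    open ≤-Reasoning
    rearrange : ∀ a b c → a * (b + c) + 1 ≡ (a * c + 1) + a * b
    rearrange = solve-∀

  lower : 2 ^ n ≤ 2 * n * p n + n * length (smallKeys n) + 1
  lower = ≤-trans polygon-bound (+-monoˡ-≤ 1 (+-monoʳ-≤ (2 * n * p n) (*-monoʳ-≤ n nonPolygonal-count)))

∣-∣-≤ : ∀ a b {c d} → a ≤ b + c → b ≤ a + d → ∣ a - b ∣ ≤ c + d
∣-∣-≤ a b {c} {d} a≤ b≤ with ∣m-n∣≡[m∸n]∨[n∸m] a b
... | inj₁ eq = subst (_≤ c + d) (sym eq) (≤-trans (m≤n+o⇒m∸n≤o a b a≤) (m≤m+n c d))
... | inj₂ eq = subst (_≤ c + d) (sym eq) (≤-trans (m≤n+o⇒m∸n≤o b a b≤) (m≤n+m d c))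

counting-error : ∀ s → ∣ suc s * p (suc s) - 2 ^ s ∣ ≤ suc s * length (symKeys (suc s)) + (suc s * length (smallKeys (suc s)) + 1)
counting-error s = ∣-∣-≤ np X (*-cancelˡ-≤ 2 (m+n≤o⇒m≤o (2 * np) upper′)) (*-cancelˡ-≤ 2 lower′)
  where
  open PerimeterBounds s
  X = 2 ^ s
  np = n * p n
  S = n * length (symKeys n)
  B = n * length (smallKeys n)
  upper′ : 2 * np + 1 ≤ 2 * (X + S)
  upper′ = subst₂ _≤_ (cong (_+ 1) (*-assoc 2 n (p n))) (trans (cong (2 * X +_) (*-assoc 2 n _)) (sym (*-distribˡ-+ 2 X S))) upper
  lower′ : 2 * X ≤ 2 * (np + (B + 1))
  lower′ = ≤-trans (subst (2 * X ≤_) (trans (+-assoc (2 * n * p n) B 1) (cong (_+ (B + 1)) (*-assoc 2 n (p n)))) lower)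
                   (≤-trans (+-monoʳ-≤ (2 * np) (m≤n*m (B + 1) 2)) (≤-reflexive (sym (*-distribˡ-+ 2 np (B + 1)))))

-- An exponential beats a polynomial: (r+8)^5 ≤ 8^5·2^r, since going from r
-- to r+1 multiplies the left side by ((r+9)/(r+8))^5 ≤ (9/8)^5 < 2.
quintic≤exponential : ∀ r → (r + 8) ^ 5 ≤ 8 ^ 5 * 2 ^ r
quintic≤exponential zero    = ≤-refl
quintic≤exponential (suc r) = begin
  (suc r + 8) ^ 5       ≤⟨ m≤m+n ((suc r + 8) ^ 5) _ ⟩
  (suc r + 8) ^ 5 + (r ^ 5 + 35 * r ^ 4 + 470 * r ^ 3 + 2950 * r ^ 2 + 8155 * r + 6487)
                        ≡⟨ doubling r ⟩
  2 * (r + 8) ^ 5       ≤⟨ *-monoʳ-≤ 2 (quintic≤exponential r) ⟩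
  2 * (8 ^ 5 * 2 ^ r)   ≡⟨ x*[y*z]≡y*[x*z] 2 (8 ^ 5) (2 ^ r) ⟩
  8 ^ 5 * 2 ^ suc r     ∎
  where
  open ≤-Reasoning
  x*[y*z]≡y*[x*z] : ∀ x y z → x * (y * z) ≡ y * (x * z)
  x*[y*z]≡y*[x*z] = solve-∀
  doubling : ∀ r → (suc r + 8) ^ 5 + (r ^ 5 + 35 * r ^ 4 + 470 * r ^ 3 + 2950 * r ^ 2 + 8155 * r + 6487) ≡ 2 * (r + 8) ^ 5
  doubling r = expanded r
    where
    expanded : ∀ r → suc (r + 8) * (suc (r + 8) * (suc (r + 8) * (suc (r + 8) * (suc (r + 8) * 1))))
                     + (r * (r * (r * (r * (r * 1)))) + 35 * (r * (r * (r * (r * 1)))) + 470 * (r * (r * (r * 1)))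
                        + 2950 * (r * (r * 1)) + 8155 * r + 6487)
                   ≡ 2 * ((r + 8) * ((r + 8) * ((r + 8) * ((r + 8) * ((r + 8) * 1)))))
    expanded = solve-∀

quartic<exponential : ∀ c r → c * 8 ^ 5 ≤ r → c * (r + 8) ^ 4 < 2 ^ r
quartic<exponential c r large = *-cancelʳ-< (r + 8) (c * (r + 8) ^ 4) (2 ^ r) (begin-strict
  c * (r + 8) ^ 4 * (r + 8)  ≡⟨ one-more c (r + 8) ⟩
  c * (r + 8) ^ 5            ≤⟨ *-monoʳ-≤ c (quintic≤exponential r) ⟩
  c * (8 ^ 5 * 2 ^ r)        ≡⟨ *-assoc c (8 ^ 5) (2 ^ r) ⟨
  c * 8 ^ 5 * 2 ^ r          <⟨ *-monoˡ-< (2 ^ r) (≤-<-trans large (m<m+n r (s≤s z≤n))) ⟩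
  (r + 8) * 2 ^ r            ≡⟨ *-comm (r + 8) (2 ^ r) ⟩
  2 ^ r * (r + 8)            ∎)
  where
  open ≤-Reasoning
  instance
    2^r≢0 : NonZero (2 ^ r)
    2^r≢0 = >-nonZero (m^n>0 2 r)
  one-more : ∀ c x → c * (x * (x * (x * (x * 1)))) * x ≡ c * (x * (x * (x * (x * (x * 1)))))
  one-more = solve-∀

error-bound : ∀ n → n * length (symKeys n) + (n * length (smallKeys n) + 1) ≤ 4 * (n + 2) ^ 4 * 2 ^ ⌊ n /2⌋
error-bound n = begin
  n * length (symKeys n) + (n * length (smallKeys n) + 1)
    ≡⟨ cong (λ z → n * z + (n * length (smallKeys n) + 1)) (length-symKeys n) ⟩
  n * (length (smallKeys n) + length (reflKeys n)) + (n * length (smallKeys n) + 1)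
    ≤⟨ +-mono-≤ (*-mono-≤ n≤P (+-mono-≤ small≤ refl≤)) (+-monoˡ-≤ 1 (*-mono-≤ n≤P small≤)) ⟩
  P * (K + K) + (P * K + 1)
    ≤⟨ +-monoʳ-≤ (P * (K + K)) (+-monoʳ-≤ (P * K) 1≤PK) ⟩
  P * (K + K) + (P * K + P * K)
    ≡⟨ rearrange (n + 2) H ⟩
  4 * (n + 2) ^ 4 * H
    ∎
  where
  open ≤-Reasoning
  P = n + 2
  H = 2 ^ ⌊ n /2⌋
  K = P * (P * (P * H))
  n≤P : n ≤ P
  n≤P = m≤m+n n 2
  n+1≤P : suc n ≤ P
  n+1≤P = subst (suc n ≤_) (+-comm 2 n) (n≤1+n (suc n))
  H≤PH : ∀ {X} → X ≤ P * X
  H≤PH {X} = m≤n*m X P {{>-nonZero (<-≤-trans (s≤s z≤n) n+1≤P)}}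
  small≤ : length (smallKeys n) ≤ K
  small≤ = begin
    length (smallKeys n)     ≡⟨ length-smallKeys n ⟩
    suc n * (suc n * H)      ≤⟨ *-mono-≤ n+1≤P (*-monoˡ-≤ H n+1≤P) ⟩
    P * (P * H)              ≤⟨ *-monoʳ-≤ P (*-monoʳ-≤ P H≤PH) ⟩
    K                        ∎
  refl≤ : length (reflKeys n) ≤ K
  refl≤ = begin
    length (reflKeys n)                          ≡⟨ length-reflKeys n ⟩
    suc n * (H * (suc (suc n) * suc (suc n)))    ≤⟨ *-mono-≤ n+1≤P (*-monoʳ-≤ H (≤-reflexive (cong₂ _*_ n+2≡P n+2≡P))) ⟩
    P * (H * (P * P))                            ≡⟨ cong (P *_) (reorder H P) ⟩
    K                                            ∎
    where
    n+2≡P : suc (suc n) ≡ P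
    n+2≡P = +-comm 2 n
    reorder : ∀ h p → h * (p * p) ≡ p * (p * h)
    reorder = solve-∀
  1≤PK : 1 ≤ P * K
  1≤PK = ≤-trans (m^n>0 2 ⌊ n /2⌋) (≤-trans H≤PH (≤-trans H≤PH (≤-trans H≤PH H≤PH)))
  rearrange : ∀ p h → p * (p * (p * (p * h)) + p * (p * (p * h))) + (p * (p * (p * (p * h))) + p * (p * (p * (p * h))))
                    ≡ 4 * (p * (p * (p * (p * 1)))) * h
  rearrange = solve-∀

-- Writing n = s+1 and s = ⌊n/2⌋ + r, the remaining exponent r is about n/2.
half-split : ∀ s → ⌊ suc s /2⌋ + (s ∸ ⌊ suc s /2⌋) ≡ s × suc s ≤ 2 * (s ∸ ⌊ suc s /2⌋) + 2
half-split s = h+r≡s , (begin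
  suc s              ≡⟨ cong suc h+r≡s ⟨
  suc (h + r)        ≤⟨ s≤s (+-monoˡ-≤ r h≤r+1) ⟩
  suc (r + 1 + r)    ≡⟨ rearrange r ⟩
  2 * r + 2          ∎)
  where
  open ≤-Reasoning
  h = ⌊ suc s /2⌋
  r = s ∸ h
  h+r≡s : h + r ≡ s
  h+r≡s = m+[n∸m]≡n (s≤s⁻¹ (⌊n/2⌋<n s))
  h≤r+1 : h ≤ r + 1
  h≤r+1 = +-cancelˡ-≤ h h (r + 1) (begin
    h + h          ≡⟨ cong (h +_) (+-identityʳ h) ⟨
    2 * h          ≤⟨ proj₁ (⌊/2⌋-bounds (suc s)) ⟩
    suc s          ≡⟨ cong suc h+r≡s ⟨
    suc (h + r)    ≡⟨ +-suc h r ⟨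
    h + suc r      ≡⟨ cong (h +_) (+-comm 1 r) ⟩
    h + (r + 1)    ∎)
  rearrange : ∀ r → suc (r + 1 + r) ≡ 2 * r + 2
  rearrange = solve-∀

error-negligible : ∀ k s → 64 * suc k * 8 ^ 5 ≤ s ∸ ⌊ suc s /2⌋ →
                   suc k * (4 * (suc s + 2) ^ 4 * 2 ^ ⌊ suc s /2⌋) < 2 ^ s
error-negligible k s large = begin-strict
  suc k * (4 * (suc s + 2) ^ 4 * H)          ≤⟨ *-monoʳ-≤ (suc k) (*-monoˡ-≤ H (*-monoʳ-≤ 4 (^-monoˡ-≤ 4 n+2≤))) ⟩
  suc k * (4 * (2 * (r + 8)) ^ 4 * H)        ≡⟨ rearrange (suc k) (r + 8) H ⟩
  64 * suc k * (r + 8) ^ 4 * H               <⟨ *-monoˡ-< H (quartic<exponential (64 * suc k) r large) ⟩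
  2 ^ r * H                                  ≡⟨ ^-distribˡ-+-* 2 r h ⟨
  2 ^ (r + h)                                ≡⟨ cong (2 ^_) (trans (+-comm r h) (proj₁ (half-split s))) ⟩
  2 ^ s                                      ∎
  where
  open ≤-Reasoning
  h = ⌊ suc s /2⌋
  r = s ∸ h
  H = 2 ^ h
  instance
    H≢0 : NonZero H
    H≢0 = >-nonZero (m^n>0 2 h)
  n+2≤ : suc s + 2 ≤ 2 * (r + 8)
  n+2≤ = ≤-trans (+-monoˡ-≤ 2 (proj₂ (half-split s))) (subst (2 * r + 2 + 2 ≤_) (expand r) (m≤m+n _ 12))
    where
    expand : ∀ r → 2 * r + 2 + 2 + 12 ≡ 2 * (r + 8)
    expand = solve-∀
  rearrange : ∀ a x h → a * (4 * (2 * x) ^ 4 * h) ≡ 64 * a * x ^ 4 * h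
  rearrange a x h = expanded a x h
    where
    expanded : ∀ a x h → a * (4 * ((2 * x) * ((2 * x) * ((2 * x) * ((2 * x) * 1)))) * h)
                       ≡ 64 * a * (x * (x * (x * (x * 1)))) * h
    expanded = solve-∀

theorem1p7 : (k : ℕ) → Σ ℕ (λ N → (n : ℕ) → N ≤ n → suc k * ∣ n * p n - 2 ^ (n ∸ 1) ∣ < 2 ^ (n ∸ 1))
theorem1p7 k = 2 * R + 2 , bound
  where
  R = 64 * suc k * 8 ^ 5
  bound : (n : ℕ) → 2 * R + 2 ≤ n → suc k * ∣ n * p n - 2 ^ (n ∸ 1) ∣ < 2 ^ (n ∸ 1)
  bound (suc s) N≤n = begin-strict
    suc k * ∣ suc s * p (suc s) - 2 ^ s ∣                  ≤⟨ *-monoʳ-≤ (suc k) (counting-error s) ⟩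
    suc k * (suc s * length (symKeys (suc s)) + (suc s * length (smallKeys (suc s)) + 1))
                                                           ≤⟨ *-monoʳ-≤ (suc k) (error-bound (suc s)) ⟩
    suc k * (4 * (suc s + 2) ^ 4 * 2 ^ ⌊ suc s /2⌋)        <⟨ error-negligible k s r-large ⟩
    2 ^ s                                                  ∎
    where
    open ≤-Reasoning
    -- n ≥ 2R + 2 and n ≤ 2r + 2 force r ≥ R
    r-large : R ≤ s ∸ ⌊ suc s /2⌋
    r-large = *-cancelˡ-≤ 2 (+-cancelʳ-≤ 2 (2 * R) _ (≤-trans N≤n (proj₂ (half-split s))))
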